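{- Let $t\ge1$ and let $Q\in\mathbb{Z}[X_1,\dots,X_t]$ be a nonzero polynomial of degree $g\ge1$. For every prime $p$ and every integer $\nu\ge1$, $$\varrho_Q^+(p^\nu)\le g^t(\nu+1)^{t-1}p^{\nu(t-1/g)+v_p(c(Q))/g}.$$
   Context: For $T\in\mathbb{Z}[X_1,\dots,X_t]$ and $s\ge1$, $\varrho_T^+(s) := \#\{\boldsymbol{\xi}\in\{1,\dots,s\}^t : T(\boldsymbol{\xi})\equiv0\pmod s\}$. $c(Q)$ denotes the content of $Q$ (the gcd of its coefficients) and $v_p(n)$ the $p$-adic valuation of the integer $n$. -}

module Defs where

open import Data.Nat using (ℕ; zero; suc; _+_; _∸_; _≤_)
open import Data.Nat.Divisibility using (_∣_; _∣?_)
open import Data.Nat.GCD using (gcd)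
open import Data.Integer as ℤ using (ℤ; ∣_∣; +_)
open import Data.List using (List; []; _∷_; map; concatMap; length; filter; upTo)
open import Data.Vec using (Vec; []; _∷_)
open import Data.Product using (Σ; _×_; _,_)
open import Relation.Nullary using (¬_)
open import Relation.Binary.PropositionalEquality using (_≡_)

-- Polynomials in ℤ[X₁,…,X_t], dense recursive representation:
-- Poly 0 = ℤ (constants); Poly (suc t) = list of coefficients
-- c₀, c₁, … ∈ ℤ[X₂,…,X_{t+1}] standing for Σ_k c_k X₁^k.
-- Each coefficient of the polynomial is exactly one leaf.
Poly : ℕ → Set
Poly zero    = ℤ
Poly (suc t) = List (Poly t)

eval : ∀ {t} → Poly t → Vec ℤ t → ℤ
eval {zero}  c  []       = c
eval {suc t} cs (x ∷ xs) = go cs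
  where
  go : List (Poly t) → ℤ
  go []       = + 0
  go (c ∷ cs) = eval c xs ℤ.+ x ℤ.* go cs

zeroP : ∀ t → Poly t
zeroP zero    = + 0
zeroP (suc t) = []

coeff : ∀ {t} → Poly t → Vec ℕ t → ℤ
coeff {zero}  c  []       = c
coeff {suc t} [] (e ∷ es) = + 0
coeff {suc t} (c ∷ cs) (zero  ∷ es) = coeff c es
coeff {suc t} (c ∷ cs) (suc e ∷ es) = coeff {suc t} cs (e ∷ es)

totalDeg : ∀ {t} → Vec ℕ t → ℕ
totalDeg []       = 0
totalDeg (e ∷ es) = e + totalDeg es

HasDegree : ∀ {t} → Poly t → ℕ → Set
HasDegree {t} Q g =
  Σ (Vec ℕ t) (λ e → ¬ (coeff Q e ≡ + 0) × totalDeg e ≡ g)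
  × (∀ (e : Vec ℕ t) → ¬ (coeff Q e ≡ + 0) → totalDeg e ≤ g)

content : ∀ {t} → Poly t → ℕ
content {zero}  c        = ∣ c ∣
content {suc t} []       = 0
content {suc t} (c ∷ cs) = gcd (content c) (content {suc t} cs)

IsValuation : ℕ → ℕ → ℕ → Set
IsValuation p n v = (p Data.Nat.^ v) ∣ n × ¬ ((p Data.Nat.^ suc v) ∣ n)

boxVecs : ∀ t → ℕ → List (Vec ℤ t)
boxVecs zero    s = [] ∷ []
boxVecs (suc t) s =
  concatMap (λ i → map (λ xs → (+ suc i) ∷ xs) (boxVecs t s)) (upTo s)

rhoPlus : ∀ {t} → Poly t → ℕ → ℕ
rhoPlus {t} Q s = length (filter (λ ξ → s ∣? ∣ eval Q ξ ∣) (boxVecs t s))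

{-# OPTIONS --safe #-}
module Submission where

-- Bounds of the shape N ≤ C · p^(e/g) are stated throughout as N ^ g ≤ C ^ g · p ^ e, so that they live in ℕ.
--
-- Split the roots of f modulo p^ν by their residue r modulo p.  If f vanishes to order exactly m
-- at r modulo p, then f (r + pY) = p^k · u(Y) with k ≤ m and u of degree ≤ k modulo p, so the roots over r are
-- counted by the roots of u modulo p^(ν − k).  Since these orders add up to at most d = deg (f mod p), induction
-- on ν and the triangle inequality for g-th roots give  #roots ≤ d · p^(ν(1 − 1/g)).  If instead exactly p^w
-- divides the content of f, the same argument gives  #roots ≤ g · p^(ν(1 − 1/g) + w/g).
--
-- Fixing all variables but the first leaves a polynomial in one variable whose content has
-- some valuation j ≤ ν.  The points where it is j lie in the zero set modulo p^j of the coefficient of Q that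
-- carries a unit coefficient, which is bounded by induction on the number of variables; the ν + 1 possible
-- values of j produce the factor (ν + 1).  Dividing Q by p^(v_p(c(Q))) reduces the theorem to this case.

open import Data.Nat using (ℕ)
open import Data.Nat.Primality using (Prime)
open import Defs using (Poly; eval; coeff; totalDeg; content; boxVecs; rhoPlus)

module Counting where

  open import Data.Nat using (ℕ; zero; suc; _+_; _*_; _^_; _≤_; _<_; z≤n; s≤s)
  open import Data.Nat.Properties
  open import Data.Nat.Tactic.RingSolver using (solve-∀)
  open import Data.Vec using (Vec; []; _∷_; map)
  open import Data.Vec.Relation.Binary.Pointwise.Inductive as Pointwise using (Pointwise; []; _∷_)
  open import Data.Sum using (inj₁; inj₂)
  open import Data.Empty using (⊥-elim)
  open import Relation.Nullary using (¬_; Dec; yes; no)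
  open import Relation.Binary.PropositionalEquality
  open import Relation.Binary.Core using (_Preserves_⟶_)
  open import Relation.Binary.Definitions using (Reflexive)

  𝟙 : ∀ {a} {A : Set a} → Dec A → ℕ
  𝟙 (yes _) = 1
  𝟙 (no _)  = 0

  𝟙-cong : ∀ {a b} {A : Set a} {B : Set b} (x : Dec A) (y : Dec B) → (A → B) → (B → A) → 𝟙 x ≡ 𝟙 y
  𝟙-cong (yes _) (yes _) _ _ = refl
  𝟙-cong (yes a) (no ¬b) f _ = ⊥-elim (¬b (f a))
  𝟙-cong (no ¬a) (yes b) _ g = ⊥-elim (¬a (g b))
  𝟙-cong (no _)  (no _)  _ _ = refl

  𝟙≤1 : ∀ {a} {A : Set a} (x : Dec A) → 𝟙 x ≤ 1
  𝟙≤1 (yes _) = s≤s z≤n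
  𝟙≤1 (no _)  = z≤n

  𝟙-yes : ∀ {a} {A : Set a} (x : Dec A) → A → 𝟙 x ≡ 1
  𝟙-yes (yes _) _ = refl
  𝟙-yes (no ¬a) a = ⊥-elim (¬a a)

  𝟙-no : ∀ {a} {A : Set a} (x : Dec A) → ¬ A → 𝟙 x ≡ 0
  𝟙-no (yes a) ¬a = ⊥-elim (¬a a)
  𝟙-no (no _)  _  = refl

  Σ< : (ℕ → ℕ) → ℕ → ℕ
  Σ< f zero    = 0
  Σ< f (suc n) = Σ< f n + f n

  Σ<-cong : ∀ {f g : ℕ → ℕ} n → (∀ i → i < n → f i ≡ g i) → Σ< f n ≡ Σ< g n
  Σ<-cong zero    _   = refl
  Σ<-cong (suc n) f≡g = cong₂ _+_ (Σ<-cong n (λ i i<n → f≡g i (m<n⇒m<1+n i<n))) (f≡g n ≤-refl)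

  Σ<-mono-≤ : ∀ {f g : ℕ → ℕ} n → (∀ i → i < n → f i ≤ g i) → Σ< f n ≤ Σ< g n
  Σ<-mono-≤ zero    _   = z≤n
  Σ<-mono-≤ (suc n) f≤g = +-mono-≤ (Σ<-mono-≤ n (λ i i<n → f≤g i (m<n⇒m<1+n i<n))) (f≤g n ≤-refl)

  Σ<-const : ∀ c n → Σ< (λ _ → c) n ≡ n * c
  Σ<-const c zero    = refl
  Σ<-const c (suc n) = trans (cong (_+ c) (Σ<-const c n)) (+-comm (n * c) c)

  Σ<-zero : ∀ n → Σ< (λ _ → 0) n ≡ 0
  Σ<-zero n = trans (Σ<-const 0 n) (*-zeroʳ n)

  Σ<-distrib-+ : ∀ (f g : ℕ → ℕ) n → Σ< (λ i → f i + g i) n ≡ Σ< f n + Σ< g n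
  Σ<-distrib-+ f g zero    = refl
  Σ<-distrib-+ f g (suc n) =
    trans (cong (_+ (f n + g n)) (Σ<-distrib-+ f g n)) (interchange (Σ< f n) (Σ< g n) (f n) (g n))
    where
    interchange : ∀ a b c d → a + b + (c + d) ≡ a + c + (b + d)
    interchange = solve-∀

  Σ<-*ˡ : ∀ c (f : ℕ → ℕ) n → Σ< (λ i → c * f i) n ≡ c * Σ< f n
  Σ<-*ˡ c f zero    = sym (*-zeroʳ c)
  Σ<-*ˡ c f (suc n) = trans (cong (_+ c * f n) (Σ<-*ˡ c f n)) (sym (*-distribˡ-+ c (Σ< f n) (f n)))

  Σ<-comm : ∀ (F : ℕ → ℕ → ℕ) m n → Σ< (λ i → Σ< (F i) n) m ≡ Σ< (λ j → Σ< (λ i → F i j) m) n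
  Σ<-comm F zero    n = sym (Σ<-zero n)
  Σ<-comm F (suc m) n =
    trans (cong (_+ Σ< (F m) n) (Σ<-comm F m n)) (sym (Σ<-distrib-+ (λ j → Σ< (λ i → F i j) m) (F m) n))

  Σ<-+ : ∀ (f : ℕ → ℕ) m n → Σ< f (m + n) ≡ Σ< f m + Σ< (λ i → f (m + i)) n
  Σ<-+ f m zero    rewrite +-identityʳ m = sym (+-identityʳ _)
  Σ<-+ f m (suc n) rewrite +-suc m n | Σ<-+ f m n = +-assoc (Σ< f m) _ _

  Σ<-suc : ∀ (f : ℕ → ℕ) n → Σ< f (suc n) ≡ f 0 + Σ< (λ i → f (suc i)) n
  Σ<-suc f n = Σ<-+ f 1 n

  Σ<-* : ∀ (f : ℕ → ℕ) a b → Σ< f (a * b) ≡ Σ< (λ r → Σ< (λ y → f (r + a * y)) b) a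
  Σ<-* f a zero    rewrite *-zeroʳ a = sym (Σ<-zero a)
  Σ<-* f a (suc b) = begin
    Σ< f (a * suc b)                                          ≡⟨ cong (Σ< f) (trans (*-suc a b) (+-comm a (a * b))) ⟩
    Σ< f (a * b + a)                                          ≡⟨ Σ<-+ f (a * b) a ⟩
    Σ< f (a * b) + Σ< (λ r → f (a * b + r)) a                 ≡⟨ cong₂ _+_ (Σ<-* f a b) (Σ<-cong a (λ r _ → cong f (+-comm (a * b) r))) ⟩
    Σ< (λ r → Σ< (λ y → f (r + a * y)) b) a + Σ< (λ r → f (r + a * b)) a
                                                              ≡⟨ Σ<-distrib-+ _ _ a ⟨
    Σ< (λ r → Σ< (λ y → f (r + a * y)) (suc b)) a             ∎
    where open ≡-Reasoning

  Σ<-periodic : ∀ (f : ℕ → ℕ) m n → (∀ i → f (i + m) ≡ f i) → Σ< f (m * n) ≡ n * Σ< f m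
  Σ<-periodic f m n periodic = begin
    Σ< f (m * n)                                ≡⟨ Σ<-* f m n ⟩
    Σ< (λ r → Σ< (λ y → f (r + m * y)) n) m     ≡⟨ Σ<-cong m (λ r _ → Σ<-cong n (λ y _ → f[r+my]≡f[r] r y)) ⟩
    Σ< (λ r → Σ< (λ _ → f r) n) m               ≡⟨ Σ<-cong m (λ r _ → Σ<-const (f r) n) ⟩
    Σ< (λ r → n * f r) m                        ≡⟨ Σ<-*ˡ n f m ⟩
    n * Σ< f m                                  ∎
    where
    open ≡-Reasoning
    f[r+my]≡f[r] : ∀ r y → f (r + m * y) ≡ f r
    f[r+my]≡f[r] r zero    = cong f (trans (cong (r +_) (*-zeroʳ m)) (+-identityʳ r))
    f[r+my]≡f[r] r (suc y) = begin
      f (r + m * suc y)   ≡⟨ cong f (trans (cong (r +_) (trans (*-suc m y) (+-comm m (m * y)))) (sym (+-assoc r (m * y) m))) ⟩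
      f (r + m * y + m)   ≡⟨ periodic (r + m * y) ⟩
      f (r + m * y)       ≡⟨ f[r+my]≡f[r] r y ⟩
      f r                 ∎

  Σ<-rotate : ∀ (f : ℕ → ℕ) n → f n ≡ f 0 → Σ< (λ i → f (suc i)) n ≡ Σ< f n
  Σ<-rotate f n fn≡f0 = +-cancelʳ-≡ (f n) _ _ (begin
    Σ< (λ i → f (suc i)) n + f n   ≡⟨ cong (Σ< (λ i → f (suc i)) n +_) fn≡f0 ⟩
    Σ< (λ i → f (suc i)) n + f 0   ≡⟨ +-comm _ (f 0) ⟩
    f 0 + Σ< (λ i → f (suc i)) n   ≡⟨ Σ<-suc f n ⟨
    Σ< f n + f n                   ∎)
    where open ≡-Reasoning

  Σ<-term-≤ : ∀ (f : ℕ → ℕ) n i → i < n → f i ≤ Σ< f n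
  Σ<-term-≤ f (suc n) i (s≤s i≤n) with m≤n⇒m<n∨m≡n i≤n
  ... | inj₁ i<n  = ≤-trans (Σ<-term-≤ f n i i<n) (m≤m+n _ _)
  ... | inj₂ refl = m≤n+m _ _

  Σ<-𝟙≤ : ∀ {a} {A : ℕ → Set a} (A? : ∀ i → Dec (A i)) n → Σ< (λ i → 𝟙 (A? i)) n ≤ n
  Σ<-𝟙≤ A? n = ≤-trans (Σ<-mono-≤ n (λ i _ → 𝟙≤1 (A? i))) (≤-reflexive (trans (Σ<-const 1 n) (*-identityʳ n)))

  Σ<-select : ∀ (w x : ℕ) n → w < n → Σ< (λ j → 𝟙 (w ≟ j) * x) n ≡ x
  Σ<-select w x (suc n) (s≤s w≤n) with m≤n⇒m<n∨m≡n w≤n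
  ... | inj₁ w<n  = trans (cong₂ _+_ (Σ<-select w x n w<n) (cong (_* x) (𝟙-no (w ≟ n) (λ w≡n → <-irrefl w≡n w<n)))) (+-identityʳ x)
  ... | inj₂ refl = trans (cong₂ _+_ (Σ<-none w ≤-refl) (cong (_* x) (𝟙-yes (w ≟ w) refl))) (*-identityˡ x)
    where
    Σ<-none : ∀ n → n ≤ w → Σ< (λ j → 𝟙 (w ≟ j) * x) n ≡ 0
    Σ<-none zero    _     = refl
    Σ<-none (suc n) 1+n≤w = cong₂ _+_ (Σ<-none n (<⇒≤ 1+n≤w)) (cong (_* x) (𝟙-no (w ≟ n) (λ w≡n → <-irrefl (sym w≡n) 1+n≤w)))

  ^-distribʳ-* : ∀ a b n → (a * b) ^ n ≡ a ^ n * b ^ n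
  ^-distribʳ-* a b zero    = refl
  ^-distribʳ-* a b (suc n) = trans (cong (a * b *_) (^-distribʳ-* a b n)) (interchange a b (a ^ n) (b ^ n))
    where
    interchange : ∀ a b x y → a * b * (x * y) ≡ a * x * (b * y)
    interchange = solve-∀

  0^-pos : ∀ g → 1 ≤ g → 0 ^ g ≡ 0
  0^-pos (suc g) _ = refl

  ^≤0⇒≡0 : ∀ x g → x ^ g ≤ 0 → x ≡ 0
  ^≤0⇒≡0 zero    g _        = refl
  ^≤0⇒≡0 (suc x) g x^g≤0 with ≤-trans (m^n>0 (suc x) g) x^g≤0
  ... | ()

  -- Reading  x ^ g ≤ m ^ g * P  as  x ≤ m · P^(1/g),  the minkowski lemmas are the triangle inequality for g-th roots.
  minkowski-ordered : ∀ g {x X m} M {P} → 1 ≤ g → x * M ≤ X * m →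
                      x ^ g ≤ m ^ g * P → X ^ g ≤ M ^ g * P → (x + X) ^ g ≤ (m + M) ^ g * P
  minkowski-ordered g {x} {X} {m} zero {P} g≥1 _ hx hX
    with ^≤0⇒≡0 X g (≤-trans hX (≤-reflexive (cong (_* P) (0^-pos g g≥1))))
  ... | refl rewrite +-identityʳ x | +-identityʳ m = hx
  minkowski-ordered g {x} {X} {m} M@(suc _) {P} _ xM≤Xm _ hX =
    *-cancelʳ-≤ ((x + X) ^ g) ((m + M) ^ g * P) (M ^ g) {{m^n≢0 M g}} (begin
      (x + X) ^ g * M ^ g      ≡⟨ ^-distribʳ-* (x + X) M g ⟨
      ((x + X) * M) ^ g        ≤⟨ ^-monoˡ-≤ g [x+X]M≤X[m+M] ⟩
      (X * (m + M)) ^ g        ≡⟨ ^-distribʳ-* X (m + M) g ⟩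
      X ^ g * (m + M) ^ g      ≤⟨ *-monoˡ-≤ ((m + M) ^ g) hX ⟩
      M ^ g * P * (m + M) ^ g  ≡⟨ rearrange (M ^ g) P ((m + M) ^ g) ⟩
      (m + M) ^ g * P * M ^ g  ∎)
    where
    open ≤-Reasoning
    [x+X]M≤X[m+M] : (x + X) * M ≤ X * (m + M)
    [x+X]M≤X[m+M] = begin
      (x + X) * M    ≡⟨ *-distribʳ-+ M x X ⟩
      x * M + X * M  ≤⟨ +-monoˡ-≤ (X * M) xM≤Xm ⟩
      X * m + X * M  ≡⟨ *-distribˡ-+ X m M ⟨
      X * (m + M)    ∎
    rearrange : ∀ a b c → a * b * c ≡ c * b * a
    rearrange = solve-∀

  minkowski-+ : ∀ g → 1 ≤ g → ∀ {x X m M P} → x ^ g ≤ m ^ g * P → X ^ g ≤ M ^ g * P → (x + X) ^ g ≤ (m + M) ^ g * P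
  minkowski-+ g g≥1 {x} {X} {m} {M} hx hX with ≤-total (x * M) (X * m)
  ... | inj₁ xM≤Xm = minkowski-ordered g M g≥1 xM≤Xm hx hX
  ... | inj₂ Xm≤xM rewrite +-comm x X | +-comm m M = minkowski-ordered g m g≥1 Xm≤xM hX hx

  minkowski-Σ< : ∀ g → 1 ≤ g → ∀ (f m : ℕ → ℕ) P n → (∀ i → i < n → f i ^ g ≤ m i ^ g * P) → Σ< f n ^ g ≤ Σ< m n ^ g * P
  minkowski-Σ< g g≥1 f m P zero    _  rewrite 0^-pos g g≥1 = z≤n
  minkowski-Σ< g g≥1 f m P (suc n) hf =
    minkowski-+ g g≥1 (minkowski-Σ< g g≥1 f m P n (λ i i<n → hf i (m<n⇒m<1+n i<n))) (hf n ≤-refl)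

  minkowski-Σ<-const : ∀ g → 1 ≤ g → ∀ (f : ℕ → ℕ) P n → (∀ i → i < n → f i ^ g ≤ P) → Σ< f n ^ g ≤ n ^ g * P
  minkowski-Σ<-const g g≥1 f P n hf =
    subst (λ k → Σ< f n ^ g ≤ k ^ g * P) (trans (Σ<-const 1 n) (*-identityʳ n))
      (minkowski-Σ< g g≥1 f (λ _ → 1) P n (λ i i<n → ≤-trans (hf i i<n) (≤-reflexive (sym 1^g*P≡P))))
    where
    1^g*P≡P : 1 ^ g * P ≡ P
    1^g*P≡P = trans (cong (_* P) (^-zeroˡ g)) (*-identityˡ P)

  Σbox : ∀ t → ℕ → (Vec ℕ t → ℕ) → ℕ
  Σbox zero    s F = F []
  Σbox (suc t) s F = Σ< (λ i → Σbox t s (λ ξ → F (i ∷ ξ))) s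

  Σbox-cong : ∀ t s {F G : Vec ℕ t → ℕ} → (∀ ξ → F ξ ≡ G ξ) → Σbox t s F ≡ Σbox t s G
  Σbox-cong zero    s F≡G = F≡G []
  Σbox-cong (suc t) s F≡G = Σ<-cong s (λ i _ → Σbox-cong t s (λ ξ → F≡G (i ∷ ξ)))

  Σbox-mono-≤ : ∀ t s {F G : Vec ℕ t → ℕ} → (∀ ξ → F ξ ≤ G ξ) → Σbox t s F ≤ Σbox t s G
  Σbox-mono-≤ zero    s F≤G = F≤G []
  Σbox-mono-≤ (suc t) s F≤G = Σ<-mono-≤ s (λ i _ → Σbox-mono-≤ t s (λ ξ → F≤G (i ∷ ξ)))

  Σbox-≤1 : ∀ t s (F : Vec ℕ t → ℕ) → (∀ ξ → F ξ ≤ 1) → Σbox t s F ≤ s ^ t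
  Σbox-≤1 zero    s F F≤1 = F≤1 []
  Σbox-≤1 (suc t) s F F≤1 =
    ≤-trans (Σ<-mono-≤ s (λ i _ → Σbox-≤1 t s _ (λ ξ → F≤1 (i ∷ ξ)))) (≤-reflexive (Σ<-const (s ^ t) s))

  Σbox-Σ< : ∀ t s (F : ℕ → Vec ℕ t → ℕ) n → Σbox t s (λ ξ → Σ< (λ j → F j ξ) n) ≡ Σ< (λ j → Σbox t s (F j)) n
  Σbox-Σ< zero    s F n = refl
  Σbox-Σ< (suc t) s F n =
    trans (Σ<-cong s (λ i _ → Σbox-Σ< t s (λ j ξ → F j (i ∷ ξ)) n)) (Σ<-comm (λ i j → Σbox t s (λ ξ → F j (i ∷ ξ))) s n)

  minkowski-Σbox : ∀ g → 1 ≤ g → ∀ t s (F M : Vec ℕ t → ℕ) P → (∀ ξ → F ξ ^ g ≤ M ξ ^ g * P) → Σbox t s F ^ g ≤ Σbox t s M ^ g * P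
  minkowski-Σbox g g≥1 zero    s F M P hF = hF []
  minkowski-Σbox g g≥1 (suc t) s F M P hF =
    minkowski-Σ< g g≥1 _ _ P s (λ i _ → minkowski-Σbox g g≥1 t s (λ ξ → F (i ∷ ξ)) (λ ξ → M (i ∷ ξ)) P (λ ξ → hF (i ∷ ξ)))

  module _ {R : ℕ → ℕ → Set} (R-refl : Reflexive R) where

    private
      respects-tail : ∀ {t} {F : Vec ℕ (suc t) → ℕ} i → F Preserves Pointwise R ⟶ _≡_ → (λ ξ → F (i ∷ ξ)) Preserves Pointwise R ⟶ _≡_
      respects-tail i F-resp ξRξ' = F-resp (R-refl ∷ ξRξ')

      head-respects : ∀ t s {F : Vec ℕ (suc t) → ℕ} {a b} → R a b → F Preserves Pointwise R ⟶ _≡_ →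
                      Σbox t s (λ ξ → F (a ∷ ξ)) ≡ Σbox t s (λ ξ → F (b ∷ ξ))
      head-respects t s aRb F-resp = Σbox-cong t s (λ ξ → F-resp (aRb ∷ Pointwise.refl R-refl))

    Σbox-periodic : ∀ m → (∀ a → R (a + m) a) → ∀ t n (F : Vec ℕ t → ℕ) → F Preserves Pointwise R ⟶ _≡_ →
                    Σbox t (m * n) F ≡ n ^ t * Σbox t m F
    Σbox-periodic m R-period zero    n F F-resp = sym (+-identityʳ _)
    Σbox-periodic m R-period (suc t) n F F-resp = begin
      Σ< (λ i → Σbox t (m * n) (λ ξ → F (i ∷ ξ))) (m * n)   ≡⟨ Σ<-cong (m * n) (λ i _ → Σbox-periodic m R-period t n _ (respects-tail i F-resp)) ⟩
      Σ< (λ i → n ^ t * slice i) (m * n)                    ≡⟨ Σ<-*ˡ (n ^ t) slice (m * n) ⟩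
      n ^ t * Σ< slice (m * n)                              ≡⟨ cong (n ^ t *_) (Σ<-periodic slice m n (λ i → head-respects t m (R-period i) F-resp)) ⟩
      n ^ t * (n * Σ< slice m)                              ≡⟨ rearrange (n ^ t) n (Σ< slice m) ⟩
      n * n ^ t * Σ< slice m                                ∎
      where
      open ≡-Reasoning
      slice : ℕ → ℕ
      slice i = Σbox t m (λ ξ → F (i ∷ ξ))
      rearrange : ∀ a b c → a * (b * c) ≡ b * a * c
      rearrange = solve-∀

    Σbox-rotate : ∀ s → R s 0 → ∀ t (F : Vec ℕ t → ℕ) → F Preserves Pointwise R ⟶ _≡_ →
                  Σbox t s (λ ξ → F (map suc ξ)) ≡ Σbox t s F
    Σbox-rotate s sR0 zero    F F-resp = refl
    Σbox-rotate s sR0 (suc t) F F-resp =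
      trans (Σ<-cong s (λ i _ → Σbox-rotate s sR0 t _ (respects-tail (suc i) F-resp)))
            (Σ<-rotate (λ i → Σbox t s (λ ξ → F (i ∷ ξ))) s (head-respects t s sR0 F-resp))

  Σbox-partition : ∀ t s (F w : Vec ℕ t → ℕ) n → (∀ ξ → w ξ < n) → Σbox t s F ≡ Σ< (λ j → Σbox t s (λ ξ → 𝟙 (w ξ ≟ j) * F ξ)) n
  Σbox-partition t s F w n w<n =
    trans (Σbox-cong t s (λ ξ → sym (Σ<-select (w ξ) (F ξ) n (w<n ξ)))) (Σbox-Σ< t s (λ j ξ → 𝟙 (w ξ ≟ j) * F ξ) n)

open Counting

module Congruences where

  import Data.Nat as ℕ
  import Data.Nat.Properties as ℕ
  import Data.Nat.Divisibility as ℕ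
  import Data.Nat.Tactic.RingSolver as ℕ-Solver
  open import Data.Nat using (zero; suc; z≤n; s≤s)
  open import Data.Nat.Induction using (<-rec)
  open import Data.Nat.GCD using (gcd[m,n]∣m; gcd[m,n]∣n; gcd-greatest)
  open import Data.Nat.Primality using (euclidsLemma; prime⇒nonZero)
  open import Data.Integer hiding (suc; _^_)
  open import Data.Integer.Properties
  open import Data.Integer.Divisibility.Signed
  open import Data.Integer.Tactic.RingSolver using (solve-∀)
  open import Data.List as List using (List; []; _∷_; length; filter; concatMap; applyUpTo)
  open import Data.List.Properties using (filter-++; length-++)
  open import Data.List.Membership.Propositional using (_∈_)
  open import Data.List.Relation.Unary.Any using (here; there)
  open import Data.Vec using (Vec; []; _∷_; map; tail)
  import Data.Vec.Properties as Vec
  open import Data.Vec.Relation.Unary.All as All using (All; []; _∷_)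
  open import Data.Vec.Relation.Binary.Pointwise.Inductive using (Pointwise; []; _∷_)
  open import Data.Product using (Σ-syntax; ∃-syntax; _×_; _,_; proj₁; proj₂)
  open import Data.Sum using (_⊎_; inj₁; inj₂)
  open import Data.Empty using (⊥; ⊥-elim)
  open import Data.Unit using (⊤; tt)
  open import Level using (0ℓ)
  open import Relation.Nullary using (¬_; Dec; yes; no)
  open import Relation.Unary using (Pred; Decidable)
  open import Relation.Binary.PropositionalEquality
  open import Relation.Binary.Core using (_Preserves_⟶_)
  open import Relation.Binary.Definitions using (Reflexive)
  open import Algebra.Properties.CommutativeSemigroup ℕ.*-commutativeSemigroup using (x∙yz≈y∙xz)

  -- Polynomials in one variable, as coefficient vectors with the constant term first

  eval₁ : ∀ {n} → Vec ℤ n → ℤ → ℤ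
  eval₁ []       x = + 0
  eval₁ (c ∷ cs) x = c + x * eval₁ cs x

  quot : ∀ {n} → Vec ℤ (suc n) → ℤ → Vec ℤ n
  quot (f₀ ∷ [])      b = []
  quot (f₀ ∷ f₁ ∷ fs) b = eval₁ (f₁ ∷ fs) b ∷ quot (f₁ ∷ fs) b

  eval₁-quot : ∀ {n} (f : Vec ℤ (suc n)) b x → eval₁ f x ≡ (x - b) * eval₁ (quot f b) x + eval₁ f b
  eval₁-quot (f₀ ∷ [])      b x = identity f₀ x b
    where
    identity : ∀ f₀ x b → f₀ + x * + 0 ≡ (x - b) * + 0 + (f₀ + b * + 0)
    identity = solve-∀
  eval₁-quot (f₀ ∷ f₁ ∷ fs) b x =
    trans (cong (λ e → f₀ + x * e) (eval₁-quot (f₁ ∷ fs) b x)) (identity f₀ x b (eval₁ (quot (f₁ ∷ fs) b) x) (eval₁ (f₁ ∷ fs) b))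
    where
    identity : ∀ f₀ x b q r → f₀ + x * ((x - b) * q + r) ≡ (x - b) * (r + x * q) + (f₀ + b * r)
    identity = solve-∀

  taylor : ∀ {n} → Vec ℤ n → ℤ → Vec ℤ n
  taylor {zero}  []  b = []
  taylor {suc n} f   b = eval₁ f b ∷ taylor (quot f b) b

  eval₁-taylor : ∀ {n} (f : Vec ℤ n) b y → eval₁ (taylor f b) y ≡ eval₁ f (b + y)
  eval₁-taylor {zero}  []  b y = refl
  eval₁-taylor {suc n} f   b y = begin
    eval₁ f b + y * eval₁ (taylor (quot f b) b) y     ≡⟨ cong (λ e → eval₁ f b + y * e) (eval₁-taylor (quot f b) b y) ⟩
    eval₁ f b + y * eval₁ (quot f b) (b + y)          ≡⟨ identity b y (eval₁ (quot f b) (b + y)) (eval₁ f b) ⟩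
    (b + y - b) * eval₁ (quot f b) (b + y) + eval₁ f b ≡⟨ eval₁-quot f b (b + y) ⟨
    eval₁ f (b + y)                                   ∎
    where
    open ≡-Reasoning
    identity : ∀ b y q r → r + y * q ≡ (b + y - b) * q + r
    identity = solve-∀

  eval₁-map-* : ∀ {n} c (v : Vec ℤ n) y → eval₁ (map (c *_) v) y ≡ c * eval₁ v y
  eval₁-map-* c []      y = sym (*-zeroʳ c)
  eval₁-map-* c (x ∷ v) y = trans (cong (λ e → c * x + y * e) (eval₁-map-* c v y)) (identity c x y (eval₁ v y))
    where
    identity : ∀ c x y e → c * x + y * (c * e) ≡ c * (x + y * e)
    identity = solve-∀

  dilate : ∀ {n} → ℤ → Vec ℤ n → Vec ℤ n
  dilate c []       = []
  dilate c (x ∷ xs) = x ∷ map (c *_) (dilate c xs)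

  eval₁-dilate : ∀ {n} c (v : Vec ℤ n) y → eval₁ (dilate c v) y ≡ eval₁ v (c * y)
  eval₁-dilate c []      y = refl
  eval₁-dilate c (x ∷ v) y = begin
    x + y * eval₁ (map (c *_) (dilate c v)) y ≡⟨ cong (λ e → x + y * e) (eval₁-map-* c (dilate c v) y) ⟩
    x + y * (c * eval₁ (dilate c v) y)        ≡⟨ cong (λ e → x + y * (c * e)) (eval₁-dilate c v y) ⟩
    x + y * (c * eval₁ v (c * y))             ≡⟨ identity x y c (eval₁ v (c * y)) ⟩
    x + c * y * eval₁ v (c * y)               ∎
    where
    open ≡-Reasoning
    identity : ∀ x y c e → x + y * (c * e) ≡ x + c * y * e
    identity = solve-∀

  addConst : ∀ {n} → ℤ → Vec ℤ (suc n) → Vec ℤ (suc n)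
  addConst a (x ∷ xs) = a + x ∷ xs

  eval₁-addConst : ∀ {n} a (v : Vec ℤ (suc n)) y → eval₁ (addConst a v) y ≡ a + eval₁ v y
  eval₁-addConst a (x ∷ v) y = +-assoc a x _

  mulLinear : ∀ {n} → ℤ → Vec ℤ n → Vec ℤ (suc n)
  mulLinear c []       = + 0 ∷ []
  mulLinear c (v₀ ∷ vs) = c * v₀ ∷ addConst v₀ (mulLinear c vs)

  eval₁-mulLinear : ∀ {n} c (v : Vec ℤ n) y → eval₁ (mulLinear c v) y ≡ (c + y) * eval₁ v y
  eval₁-mulLinear c []        y = identity c y
    where
    identity : ∀ c y → + 0 + y * + 0 ≡ (c + y) * + 0
    identity = solve-∀
  eval₁-mulLinear c (v₀ ∷ vs) y = begin
    c * v₀ + y * eval₁ (addConst v₀ (mulLinear c vs)) y ≡⟨ cong (λ e → c * v₀ + y * e) (eval₁-addConst v₀ (mulLinear c vs) y) ⟩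
    c * v₀ + y * (v₀ + eval₁ (mulLinear c vs) y)        ≡⟨ cong (λ e → c * v₀ + y * (v₀ + e)) (eval₁-mulLinear c vs y) ⟩
    c * v₀ + y * (v₀ + (c + y) * eval₁ vs y)            ≡⟨ identity c y v₀ (eval₁ vs y) ⟩
    (c + y) * (v₀ + y * eval₁ vs y)                     ∎
    where
    open ≡-Reasoning
    identity : ∀ c y v₀ e → c * v₀ + y * (v₀ + (c + y) * e) ≡ (c + y) * (v₀ + y * e)
    identity = solve-∀

  private
    multiple-of-1+∣∣⇒0 : ∀ z k → z ≡ + suc ∣ z ∣ * k → z ≡ + 0
    multiple-of-1+∣∣⇒0 z k z≡ = helper ∣ k ∣ (trans (cong ∣_∣ z≡) (abs-* (+ suc ∣ z ∣) k))
      where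
      helper : ∀ m → ∣ z ∣ ≡ suc ∣ z ∣ ℕ.* m → z ≡ + 0
      helper zero    ∣z∣≡ = ∣i∣≡0⇒i≡0 (trans ∣z∣≡ (ℕ.*-zeroʳ (suc ∣ z ∣)))
      helper (suc m) ∣z∣≡ = ⊥-elim (ℕ.<-irrefl refl (ℕ.≤-trans (ℕ.m≤m*n (suc ∣ z ∣) (suc m)) (ℕ.≤-reflexive (sym ∣z∣≡))))

  -- Evaluating at x = 1 + ∣u₀ - v₀∣ separates the constant terms; cancelling x then handles the tails.
  eval₁-injective : ∀ {n} (u v : Vec ℤ n) → (∀ x → x ≢ + 0 → eval₁ u x ≡ eval₁ v x) → u ≡ v
  eval₁-injective []        []        _   = refl
  eval₁-injective (u₀ ∷ us) (v₀ ∷ vs) u≗v = cong₂ _∷_ u₀≡v₀ (eval₁-injective us vs us≗vs)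
    where
    difference : ∀ x → x ≢ + 0 → u₀ - v₀ ≡ x * (eval₁ vs x - eval₁ us x)
    difference x x≢0 = begin
      u₀ - v₀                                      ≡⟨ identity₁ u₀ v₀ x (eval₁ us x) ⟩
      (u₀ + x * eval₁ us x) - v₀ - x * eval₁ us x  ≡⟨ cong (λ e → e - v₀ - x * eval₁ us x) (u≗v x x≢0) ⟩
      (v₀ + x * eval₁ vs x) - v₀ - x * eval₁ us x  ≡⟨ identity₂ v₀ x (eval₁ vs x) (eval₁ us x) ⟩
      x * (eval₁ vs x - eval₁ us x)                ∎
      where
      open ≡-Reasoning
      identity₁ : ∀ u₀ v₀ x e → u₀ - v₀ ≡ (u₀ + x * e) - v₀ - x * e
      identity₁ = solve-∀
      identity₂ : ∀ v₀ x e e' → v₀ + x * e - v₀ - x * e' ≡ x * (e - e')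
      identity₂ = solve-∀
    u₀≡v₀ : u₀ ≡ v₀
    u₀≡v₀ = i-j≡0⇒i≡j u₀ v₀ (multiple-of-1+∣∣⇒0 (u₀ - v₀) _ (difference (+ suc ∣ u₀ - v₀ ∣) (λ ())))
    us≗vs : ∀ x → x ≢ + 0 → eval₁ us x ≡ eval₁ vs x
    us≗vs x x≢0 = *-cancelˡ-≡ x (eval₁ us x) (eval₁ vs x) {{≢-nonZero x≢0}} (begin
      x * eval₁ us x                ≡⟨ identity u₀ x (eval₁ us x) ⟩
      (u₀ + x * eval₁ us x) - u₀    ≡⟨ cong₂ _-_ (u≗v x x≢0) u₀≡v₀ ⟩
      (v₀ + x * eval₁ vs x) - v₀    ≡⟨ identity v₀ x (eval₁ vs x) ⟨
      x * eval₁ vs x                ∎)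
      where
      open ≡-Reasoning
      identity : ∀ a x e → x * e ≡ (a + x * e) - a
      identity = solve-∀

  taylor-inverse : ∀ {n} (f : Vec ℤ n) a → taylor (taylor f a) (- a) ≡ f
  taylor-inverse f a = eval₁-injective _ _ (λ x _ → begin
    eval₁ (taylor (taylor f a) (- a)) x   ≡⟨ eval₁-taylor (taylor f a) (- a) x ⟩
    eval₁ (taylor f a) (- a + x)          ≡⟨ eval₁-taylor f a (- a + x) ⟩
    eval₁ f (a + (- a + x))               ≡⟨ cong (eval₁ f) (identity a x) ⟩
    eval₁ f x                             ∎)
    where
    open ≡-Reasoning
    identity : ∀ a x → a + (- a + x) ≡ x
    identity = solve-∀

  taylor-quot : ∀ {n} (f : Vec ℤ (suc n)) b b' → taylor f b' ≡ addConst (eval₁ f b) (mulLinear (b' - b) (taylor (quot f b) b'))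
  taylor-quot f b b' = eval₁-injective _ _ (λ y _ → begin
    eval₁ (taylor f b') y                                           ≡⟨ eval₁-taylor f b' y ⟩
    eval₁ f (b' + y)                                                ≡⟨ eval₁-quot f b (b' + y) ⟩
    (b' + y - b) * eval₁ q (b' + y) + eval₁ f b                     ≡⟨ identity b b' y (eval₁ q (b' + y)) (eval₁ f b) ⟩
    eval₁ f b + (b' - b + y) * eval₁ q (b' + y)                     ≡⟨ cong (λ e → eval₁ f b + (b' - b + y) * e) (eval₁-taylor q b' y) ⟨
    eval₁ f b + (b' - b + y) * eval₁ (taylor q b') y                ≡⟨ cong (λ e → eval₁ f b + e) (eval₁-mulLinear (b' - b) (taylor q b') y) ⟨
    eval₁ f b + eval₁ (mulLinear (b' - b) (taylor q b')) y          ≡⟨ eval₁-addConst (eval₁ f b) (mulLinear (b' - b) (taylor q b')) y ⟨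
    eval₁ (addConst (eval₁ f b) (mulLinear (b' - b) (taylor q b'))) y ∎)
    where
    open ≡-Reasoning
    q = quot f b
    identity : ∀ b b' y q r → (b' + y - b) * q + r ≡ r + (b' - b + y) * q
    identity = solve-∀

  eval₁-cong-∣ : ∀ {n} m (f : Vec ℤ n) x y → m ∣ x - y → m ∣ eval₁ f x - eval₁ f y
  eval₁-cong-∣ m []      x y _   = divides (+ 0) refl
  eval₁-cong-∣ m (c ∷ f) x y m∣x-y = subst (m ∣_) (identity c x y (eval₁ f x) (eval₁ f y))
    (∣m∣n⇒∣m+n (∣n⇒∣m*n x (eval₁-cong-∣ m f x y m∣x-y)) (∣m⇒∣m*n (eval₁ f y) m∣x-y))
    where
    identity : ∀ c x y a b → x * (a - b) + (x - y) * b ≡ c + x * a - (c + y * b)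
    identity = solve-∀

  infix 4 _∣ᵥ_ _∣ᵥ?_

  _∣ᵥ_ : ∀ {n} → ℤ → Vec ℤ n → Set
  c ∣ᵥ v = All (c ∣_) v

  _∣ᵥ?_ : ∀ {n} c (v : Vec ℤ n) → Dec (c ∣ᵥ v)
  c ∣ᵥ? v = All.all? (c ∣?_) v

  ∣ᵥ⇒∣eval₁ : ∀ {n} {c} {v : Vec ℤ n} y → c ∣ᵥ v → c ∣ eval₁ v y
  ∣ᵥ⇒∣eval₁ y []           = divides (+ 0) refl
  ∣ᵥ⇒∣eval₁ y (c∣x ∷ c∣v) = ∣m∣n⇒∣m+n c∣x (∣n⇒∣m*n y (∣ᵥ⇒∣eval₁ y c∣v))

  ∣-∣ᵥ-trans : ∀ {n} {c e} {v : Vec ℤ n} → e ∣ c → c ∣ᵥ v → e ∣ᵥ v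
  ∣-∣ᵥ-trans e∣c = All.map (∣-trans e∣c)

  ∣ᵥ-map-* : ∀ {n} c e (u : Vec ℤ n) → e ∣ᵥ u → c * e ∣ᵥ map (c *_) u
  ∣ᵥ-map-* c e []      []           = []
  ∣ᵥ-map-* c e (x ∷ u) (e∣x ∷ e∣u) = *-monoʳ-∣ c e∣x ∷ ∣ᵥ-map-* c e u e∣u

  ∣ᵥ-map-*-cancel : ∀ {n} c e (v : Vec ℤ n) → .{{NonZero c}} → c * e ∣ᵥ map (c *_) v → e ∣ᵥ v
  ∣ᵥ-map-*-cancel c e []      _               = []
  ∣ᵥ-map-*-cancel c e (x ∷ v) (ce∣cx ∷ ce∣cv) = *-cancelˡ-∣ c ce∣cx ∷ ∣ᵥ-map-*-cancel c e v ce∣cv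

  ∣ᵥ⇒map-* : ∀ {n} c (v : Vec ℤ n) → c ∣ᵥ v → Σ[ u ∈ Vec ℤ n ] v ≡ map (c *_) u
  ∣ᵥ⇒map-* c []      _                        = [] , refl
  ∣ᵥ⇒map-* c (x ∷ v) (divides q x≡qc ∷ c∣v) with ∣ᵥ⇒map-* c v c∣v
  ... | u , v≡cu = q ∷ u , cong₂ _∷_ (trans x≡qc (*-comm q c)) v≡cu

  1∣ᵥ : ∀ {n} (v : Vec ℤ n) → + 1 ∣ᵥ v
  1∣ᵥ = All.universal (λ x → ∣ᵤ⇒∣ (ℕ.1∣ ∣ x ∣))

  ∣ᵥ-map-*ˡ : ∀ {n} c (u : Vec ℤ n) → c ∣ᵥ map (c *_) u
  ∣ᵥ-map-*ˡ c []      = []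
  ∣ᵥ-map-*ˡ c (x ∷ u) = ∣m⇒∣m*n x ∣-refl ∷ ∣ᵥ-map-*ˡ c u

  -- Conditions on the coefficients of index > d, of index < e, and of index m (which must exist).
  -- AllAbove (P ∣_) d f says that f has degree ≤ d modulo P.
  AllAbove : ∀ {n} → (ℤ → Set) → ℕ → Vec ℤ n → Set
  AllAbove A _       []       = ⊤
  AllAbove A zero    (x ∷ xs) = All A xs
  AllAbove A (suc d) (x ∷ xs) = AllAbove A d xs

  AllBelow : ∀ {n} → (ℤ → Set) → ℕ → Vec ℤ n → Set
  AllBelow A zero    _        = ⊤
  AllBelow A (suc e) []       = ⊤
  AllBelow A (suc e) (x ∷ xs) = A x × AllBelow A e xs

  At : ∀ {n} → (ℤ → Set) → ℕ → Vec ℤ n → Set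
  At A _       []       = ⊥
  At A zero    (x ∷ _)  = A x
  At A (suc m) (_ ∷ xs) = At A m xs

  module _ {c : ℤ} where

    ∣ᵥ-quot : ∀ {n} (f : Vec ℤ (suc n)) b → c ∣ᵥ tail f → c ∣ᵥ quot f b
    ∣ᵥ-quot (f₀ ∷ [])      b _                    = []
    ∣ᵥ-quot (f₀ ∷ f₁ ∷ fs) b c∣f₁∷fs@(_ ∷ c∣fs) = ∣ᵥ⇒∣eval₁ b c∣f₁∷fs ∷ ∣ᵥ-quot (f₁ ∷ fs) b c∣fs

    ∣ᵥ-quot⇒∣ᵥ : ∀ {n} (f : Vec ℤ (suc n)) b → c ∣ᵥ quot f b → c ∣ eval₁ f b → c ∣ᵥ f
    ∣ᵥ-quot⇒∣ᵥ (f₀ ∷ [])      b _                   c∣f[b]  = ∣m+n∣n⇒∣m c∣f[b] (∣n⇒∣m*n b (divides (+ 0) refl)) ∷ []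
    ∣ᵥ-quot⇒∣ᵥ (f₀ ∷ f₁ ∷ fs) b (c∣f₁∷fs[b] ∷ c∣q) c∣f[b] =
      ∣m+n∣n⇒∣m c∣f[b] (∣n⇒∣m*n b c∣f₁∷fs[b]) ∷ ∣ᵥ-quot⇒∣ᵥ (f₁ ∷ fs) b c∣q c∣f₁∷fs[b]

    ∣ᵥ-taylor : ∀ {n} (f : Vec ℤ n) b → c ∣ᵥ f → c ∣ᵥ taylor f b
    ∣ᵥ-taylor {zero}  []         b _   = []
    ∣ᵥ-taylor {suc n} f@(_ ∷ _) b c∣f = ∣ᵥ⇒∣eval₁ b c∣f ∷ ∣ᵥ-taylor (quot f b) b (∣ᵥ-quot f b (All.tail c∣f))

    ¬∣ᵥ-taylor : ∀ {n} (f : Vec ℤ n) a → ¬ c ∣ᵥ f → ¬ c ∣ᵥ taylor f a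
    ¬∣ᵥ-taylor f a c∤f c∣Tf = c∤f (subst (c ∣ᵥ_) (taylor-inverse f a) (∣ᵥ-taylor (taylor f a) (- a) c∣Tf))

    AllAbove-quot : ∀ {n} d (f : Vec ℤ (suc n)) b → AllAbove (c ∣_) (suc d) f → AllAbove (c ∣_) d (quot f b)
    AllAbove-quot d       (f₀ ∷ [])      b _         = tt
    AllAbove-quot zero    (f₀ ∷ f₁ ∷ fs) b c∣fs      = ∣ᵥ-quot (f₁ ∷ fs) b c∣fs
    AllAbove-quot (suc d) (f₀ ∷ f₁ ∷ fs) b above     = AllAbove-quot d (f₁ ∷ fs) b above

  AllAbove-map : ∀ {n} {A B : ℤ → Set} → (∀ {x} → A x → B x) → ∀ d (v : Vec ℤ n) → AllAbove A d v → AllAbove B d v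
  AllAbove-map A⇒B _       []       _     = tt
  AllAbove-map A⇒B zero    (x ∷ xs) all   = All.map A⇒B all
  AllAbove-map A⇒B (suc d) (x ∷ xs) above = AllAbove-map A⇒B d xs above

  AllAbove-map-* : ∀ {n} c e d (u : Vec ℤ n) → AllAbove (e ∣_) d u → AllAbove (c * e ∣_) d (map (c *_) u)
  AllAbove-map-* c e _       []       _     = tt
  AllAbove-map-* c e zero    (x ∷ xs) e∣xs  = ∣ᵥ-map-* c e xs e∣xs
  AllAbove-map-* c e (suc d) (x ∷ xs) above = AllAbove-map-* c e d xs above

  AllAbove-map-*-cancel : ∀ {n} c e d (u : Vec ℤ n) → .{{NonZero c}} → AllAbove (c * e ∣_) d (map (c *_) u) → AllAbove (e ∣_) d u
  AllAbove-map-*-cancel c e _       []       _     = tt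
  AllAbove-map-*-cancel c e zero    (x ∷ xs) ce∣cxs = ∣ᵥ-map-*-cancel c e xs ce∣cxs
  AllAbove-map-*-cancel c e (suc d) (x ∷ xs) above  = AllAbove-map-*-cancel c e d xs above

  ∣-diff-sym : ∀ {m} a b → m ∣ a - b → m ∣ b - a
  ∣-diff-sym a b m∣a-b = ∣ᵤ⇒∣ (subst (_ ℕ.∣_) (∣i-j∣≡∣j-i∣ a b) (∣⇒∣ᵤ m∣a-b))

  ∣-diff-transfer : ∀ {m} a b → m ∣ a - b → m ∣ a → m ∣ b
  ∣-diff-transfer {m} a b m∣a-b m∣a = subst (m ∣_) (identity a b) (∣m∣n⇒∣m-n m∣a m∣a-b)
    where
    identity : ∀ a b → a - (a - b) ≡ b
    identity = solve-∀

  𝟙-∣-cong : ∀ {m} a b → m ∣ a - b → 𝟙 (m ∣? a) ≡ 𝟙 (m ∣? b)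
  𝟙-∣-cong a b m∣a-b = 𝟙-cong _ _ (∣-diff-transfer a b m∣a-b) (∣-diff-transfer b a (∣-diff-sym a b m∣a-b))

  𝟙-∣-*-cancel : ∀ c m {z u} → .{{NonZero c}} → z ≡ c * u → 𝟙 (c * m ∣? z) ≡ 𝟙 (m ∣? u)
  𝟙-∣-*-cancel c m z≡cu = 𝟙-cong _ _
    (λ cm∣z → *-cancelˡ-∣ c (subst (c * m ∣_) z≡cu cm∣z))
    (λ m∣u → subst (c * m ∣_) (sym z≡cu) (*-monoʳ-∣ c m∣u))

  count∣ : ℤ → (ℕ → ℤ) → ℕ → ℕ
  count∣ m z n = Σ< (λ i → 𝟙 (m ∣? z i)) n

  count∣-≤ : ∀ m z n → count∣ m z n ℕ.≤ n
  count∣-≤ m z n = Σ<-𝟙≤ (λ i → m ∣? z i) n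

  count∣-all : ∀ m z n → (∀ i → m ∣ z i) → count∣ m z n ≡ n
  count∣-all m z n m∣z = trans (Σ<-cong n (λ i _ → 𝟙-yes (m ∣? z i) (m∣z i))) (trans (Σ<-const 1 n) (ℕ.*-identityʳ n))

  count∣-none : ∀ m z n → (∀ i → ¬ m ∣ z i) → count∣ m z n ≡ 0
  count∣-none m z n m∤z = trans (Σ<-cong n (λ i _ → 𝟙-no (m ∣? z i) (m∤z i))) (Σ<-zero n)

  count∣-*-cancel : ∀ c m {z u} n → .{{NonZero c}} → (∀ i → z i ≡ c * u i) → count∣ (c * m) z n ≡ count∣ m u n
  count∣-*-cancel c m n z≡cu = Σ<-cong n (λ i _ → 𝟙-∣-*-cancel c m (z≡cu i))

  count∣-eval₁-periodic : ∀ {n} (f : Vec ℤ n) M K →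
    count∣ (+ M) (λ i → eval₁ f (+ i)) (M ℕ.* K) ≡ K ℕ.* count∣ (+ M) (λ i → eval₁ f (+ i)) M
  count∣-eval₁-periodic f M K = Σ<-periodic _ M K (λ i →
    𝟙-∣-cong _ _ (eval₁-cong-∣ (+ M) f (+ (i ℕ.+ M)) (+ i) (subst (+ M ∣_) (sym (shift i)) ∣-refl)))
    where
    shift : ∀ i → + (i ℕ.+ M) - + i ≡ + M
    shift i = trans (cong (_- + i) (pos-+ i M)) (identity (+ i) (+ M))
      where
      identity : ∀ a b → a + b - a ≡ b
      identity = solve-∀

  exponent-bound : ∀ a w G → suc a ℕ.≤ G → a ℕ.* G ℕ.+ w ℕ.* (G ℕ.∸ 1) ℕ.≤ (w ℕ.+ suc a) ℕ.* (G ℕ.∸ 1)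
  exponent-bound a w (suc G) (s≤s a≤G) = begin
    a ℕ.* suc G ℕ.+ w ℕ.* G          ≡⟨ identity₁ a w G ⟩
    a ℕ.+ (a ℕ.* G ℕ.+ w ℕ.* G)      ≤⟨ ℕ.+-monoˡ-≤ _ a≤G ⟩
    G ℕ.+ (a ℕ.* G ℕ.+ w ℕ.* G)      ≡⟨ identity₂ a w G ⟩
    (w ℕ.+ suc a) ℕ.* G              ∎
    where
    open ℕ.≤-Reasoning
    identity₁ : ∀ a w G → a ℕ.* suc G ℕ.+ w ℕ.* G ≡ a ℕ.+ (a ℕ.* G ℕ.+ w ℕ.* G)
    identity₁ = ℕ-Solver.solve-∀
    identity₂ : ∀ a w G → G ℕ.+ (a ℕ.* G ℕ.+ w ℕ.* G) ≡ (w ℕ.+ suc a) ℕ.* G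
    identity₂ = ℕ-Solver.solve-∀

  -- Polynomials in several variables

  fiber : ∀ {t} (cs : List (Poly t)) → Vec ℤ t → Vec ℤ (length cs)
  fiber []       ξ = []
  fiber (c ∷ cs) ξ = eval c ξ ∷ fiber cs ξ

  eval₁-fiber : ∀ {t} (cs : List (Poly t)) ξ x → eval₁ (fiber cs ξ) x ≡ eval cs (x ∷ ξ)
  eval₁-fiber []       ξ x = refl
  eval₁-fiber (c ∷ cs) ξ x = cong (λ e → eval c ξ + x * e) (eval₁-fiber cs ξ x)

  ∣ᵥ-fiber-∈ : ∀ {t} {m} {c} {cs : List (Poly t)} ξ → c ∈ cs → m ∣ᵥ fiber cs ξ → m ∣ eval c ξ
  ∣ᵥ-fiber-∈ ξ (here refl) (m∣c ∷ _)  = m∣c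
  ∣ᵥ-fiber-∈ ξ (there c∈cs) (_ ∷ m∣cs) = ∣ᵥ-fiber-∈ ξ c∈cs m∣cs

  coeff-∈ : ∀ {t} {A : ℤ → Set} (cs : List (Poly t)) k es → ¬ A (+ 0) → A (coeff cs (k ∷ es)) → ∃[ c ] c ∈ cs × A (coeff c es)
  coeff-∈ []       k       es ¬A0 A0 = ⊥-elim (¬A0 A0)
  coeff-∈ (c ∷ cs) zero    es _   Ac = c , here refl , Ac
  coeff-∈ {A = A} (c ∷ cs) (suc k) es ¬A0 Acs with coeff-∈ {A = A} cs k es ¬A0 Acs
  ... | c' , c'∈cs , Ac' = c' , there c'∈cs , Ac'

  infix 4 _≡_[mod_]

  _≡_[mod_] : ℕ → ℕ → ℕ → Set
  a ≡ b [mod m ] = + m ∣ + a - + b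

  ≡[mod]-refl : ∀ {m} → Reflexive _≡_[mod m ]
  ≡[mod]-refl {x = a} = divides (+ 0) (+-inverseʳ (+ a))

  a+m≡a[mod] : ∀ m a → a ℕ.+ m ≡ a [mod m ]
  a+m≡a[mod] m a = divides (+ 1) (trans (trans (cong (_- + a) (pos-+ a m)) (identity (+ a) (+ m))) (sym (*-identityˡ (+ m))))
    where
    identity : ∀ a b → a + b - a ≡ b
    identity = solve-∀

  m≡0[mod] : ∀ m → m ≡ 0 [mod m ]
  m≡0[mod] m = divides (+ 1) (trans (+-identityʳ (+ m)) (sym (*-identityˡ (+ m))))

  eval-cong : ∀ {t} (Q : Poly t) m {ξ ξ' : Vec ℕ t} → Pointwise _≡_[mod m ] ξ ξ' → + m ∣ eval Q (map +_ ξ) - eval Q (map +_ ξ')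
  eval-cong {zero}  c  m [] = divides (+ 0) (+-inverseʳ c)
  eval-cong {suc t} cs m {a ∷ ξ} {b ∷ ξ'} (a≡b ∷ ξ≡ξ') = horner cs
    where
    horner : ∀ (cs : List (Poly t)) → + m ∣ eval cs (+ a ∷ map +_ ξ) - eval cs (+ b ∷ map +_ ξ')
    horner []       = divides (+ 0) refl
    horner (c ∷ cs) =
      subst (+ m ∣_) (identity (eval c (map +_ ξ)) (eval c (map +_ ξ')) (+ a) (+ b) (eval cs (+ a ∷ map +_ ξ)) (eval cs (+ b ∷ map +_ ξ')))
      (∣m∣n⇒∣m+n (∣m∣n⇒∣m+n (eval-cong c m ξ≡ξ') (∣n⇒∣m*n (+ a) (horner cs))) (∣m⇒∣m*n _ a≡b))
      where
      identity : ∀ e e' a b E E' → e - e' + a * (E - E') + (a - b) * E' ≡ e + a * E - (e' + b * E')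
      identity = solve-∀

  eval-zero : ∀ {t} (Q : Poly t) → (∀ e → coeff Q e ≡ + 0) → ∀ ξ → eval Q ξ ≡ + 0
  eval-zero {zero}  c  Q≡0 []       = Q≡0 []
  eval-zero {suc t} cs Q≡0 (x ∷ ξ) = horner cs Q≡0
    where
    horner : ∀ (cs : List (Poly t)) → (∀ e → coeff cs e ≡ + 0) → eval cs (x ∷ ξ) ≡ + 0
    horner []       _    = refl
    horner (c ∷ cs) cs≡0 = begin
      eval c ξ + x * eval cs (x ∷ ξ)
        ≡⟨ cong₂ (λ u v → u + x * v) (eval-zero c (λ e → cs≡0 (0 ∷ e)) ξ) (horner cs (λ { (k ∷ e) → cs≡0 (suc k ∷ e) })) ⟩
      + 0 + x * + 0                    ≡⟨ cong (λ z → + 0 + z) (*-zeroʳ x) ⟩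
      + 0                              ∎
      where open ≡-Reasoning

  TotalDeg≤ : ∀ {t} → Poly t → ℕ → Set
  TotalDeg≤ {t} Q G = ∀ (e : Vec ℕ t) → coeff Q e ≢ + 0 → totalDeg e ℕ.≤ G

  TotalDeg≤-∈ : ∀ {t} {c} {cs : List (Poly t)} {G} → c ∈ cs → TotalDeg≤ cs G → TotalDeg≤ c G
  TotalDeg≤-∈ (here refl)  deg e c[e]≢0 = deg (0 ∷ e) c[e]≢0
  TotalDeg≤-∈ (there c∈cs) deg e c[e]≢0 =
    TotalDeg≤-∈ c∈cs (λ { (k ∷ e) ≢0 → ℕ.≤-trans (ℕ.n≤1+n _) (deg (suc k ∷ e) ≢0) }) e c[e]≢0

  fiber-zero : ∀ {t} (cs : List (Poly t)) ξ → (∀ e → coeff cs e ≡ + 0) → All (_≡ + 0) (fiber cs ξ)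
  fiber-zero []       ξ _    = []
  fiber-zero (c ∷ cs) ξ cs≡0 = eval-zero c (λ e → cs≡0 (0 ∷ e)) ξ ∷ fiber-zero cs ξ (λ { (k ∷ e) → cs≡0 (suc k ∷ e) })

  fiber-deg : ∀ {t} G (cs : List (Poly t)) ξ → TotalDeg≤ cs G → AllAbove (_≡ + 0) G (fiber cs ξ)
  fiber-deg G       []       ξ _   = tt
  fiber-deg zero    (c ∷ cs) ξ deg = fiber-zero cs ξ tail≡0
    where
    tail≡0 : ∀ e → coeff cs e ≡ + 0
    tail≡0 (k ∷ e) with coeff cs (k ∷ e) ≟ + 0
    ... | yes ≡0 = ≡0
    ... | no  ≢0 with deg (suc k ∷ e) ≢0
    ...   | ()
  fiber-deg (suc G) (c ∷ cs) ξ deg = fiber-deg G cs ξ (λ { (k ∷ e) ≢0 → ℕ.≤-pred (deg (suc k ∷ e) ≢0) })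

  countBox : ∀ {t} → ℤ → Poly t → ℕ → ℕ
  countBox {t} m Q s = Σbox t s (λ ξ → 𝟙 (m ∣? eval Q (map +_ ξ)))

  countBox-≤ : ∀ {t} m (Q : Poly t) s → countBox m Q s ℕ.≤ s ℕ.^ t
  countBox-≤ {t} m Q s = Σbox-≤1 t s _ (λ ξ → 𝟙≤1 (m ∣? eval Q (map +_ ξ)))

  countBox-fiber : ∀ {t} m (cs : List (Poly t)) s →
                   countBox m cs s ≡ Σbox t s (λ ξ → count∣ m (λ i → eval₁ (fiber cs (map +_ ξ)) (+ i)) s)
  countBox-fiber {t} m cs s = begin
    Σ< (λ i → Σbox t s (λ ξ → 𝟙 (m ∣? eval cs (+ i ∷ map +_ ξ)))) s
      ≡⟨ Σbox-Σ< t s (λ i ξ → 𝟙 (m ∣? eval cs (+ i ∷ map +_ ξ))) s ⟨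
    Σbox t s (λ ξ → Σ< (λ i → 𝟙 (m ∣? eval cs (+ i ∷ map +_ ξ))) s)
      ≡⟨ Σbox-cong t s (λ ξ → Σ<-cong s (λ i _ → cong (λ z → 𝟙 (m ∣? z)) (eval₁-fiber cs (map +_ ξ) (+ i)))) ⟨
    Σbox t s (λ ξ → count∣ m (λ i → eval₁ (fiber cs (map +_ ξ)) (+ i)) s)
      ∎
    where open ≡-Reasoning

  countBox-*-cancel : ∀ {t} c m {Q Q' : Poly t} s → .{{NonZero c}} → (∀ ξ → eval Q ξ ≡ c * eval Q' ξ) →
                      countBox (c * m) Q s ≡ countBox m Q' s
  countBox-*-cancel {t} c m s Q≡cQ' = Σbox-cong t s (λ ξ → 𝟙-∣-*-cancel c m (Q≡cQ' (map +_ ξ)))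

  𝟙-eval-respects : ∀ {t} M (Q : Poly t) → (λ ξ → 𝟙 (+ M ∣? eval Q (map +_ ξ))) Preserves Pointwise _≡_[mod M ] ⟶ _≡_
  𝟙-eval-respects M Q ξ≡ξ' = 𝟙-∣-cong _ _ (eval-cong Q M ξ≡ξ')

  countBox-periodic : ∀ {t} M (Q : Poly t) K → countBox (+ M) Q (M ℕ.* K) ≡ K ℕ.^ t ℕ.* countBox (+ M) Q M
  countBox-periodic {t} M Q K = Σbox-periodic {R = _≡_[mod M ]} (λ {a} → ≡[mod]-refl {M} {a}) M (a+m≡a[mod] M) t K _ (𝟙-eval-respects M Q)

  module _ {A : Set} {P : Pred A 0ℓ} (P? : Decidable P) where

    length-filter-[_] : ∀ x → length (filter P? (x ∷ [])) ≡ 𝟙 (P? x)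
    length-filter-[ x ] with P? x
    ... | yes _ = refl
    ... | no  _ = refl

    length-filter-map : ∀ {B : Set} (g : B → A) xs → length (filter P? (List.map g xs)) ≡ length (filter (λ x → P? (g x)) xs)
    length-filter-map g []       = refl
    length-filter-map g (x ∷ xs) with P? (g x)
    ... | yes _ = cong suc (length-filter-map g xs)
    ... | no  _ = length-filter-map g xs

    length-filter-concatMap : ∀ (F : ℕ → List A) f n → length (filter P? (concatMap F (applyUpTo f n))) ≡ Σ< (λ i → length (filter P? (F (f i)))) n
    length-filter-concatMap F f zero    = refl
    length-filter-concatMap F f (suc n) = begin
      length (filter P? (F (f 0) List.++ concatMap F (applyUpTo (λ i → f (suc i)) n)))
        ≡⟨ cong length (filter-++ P? (F (f 0)) _) ⟩
      length (filter P? (F (f 0)) List.++ filter P? (concatMap F (applyUpTo (λ i → f (suc i)) n)))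
        ≡⟨ length-++ (filter P? (F (f 0))) ⟩
      length (filter P? (F (f 0))) ℕ.+ length (filter P? (concatMap F (applyUpTo (λ i → f (suc i)) n)))
        ≡⟨ cong (length (filter P? (F (f 0))) ℕ.+_) (length-filter-concatMap F (λ i → f (suc i)) n) ⟩
      length (filter P? (F (f 0))) ℕ.+ Σ< (λ i → length (filter P? (F (f (suc i))))) n
        ≡⟨ Σ<-suc (λ i → length (filter P? (F (f i)))) n ⟨
      Σ< (λ i → length (filter P? (F (f i)))) (suc n) ∎
      where open ≡-Reasoning

  length-filter-boxVecs : ∀ t s {P : Pred (Vec ℤ t) 0ℓ} (P? : Decidable P) →
                          length (filter P? (boxVecs t s)) ≡ Σbox t s (λ ξ → 𝟙 (P? (map (λ i → + suc i) ξ)))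
  length-filter-boxVecs zero    s P? = length-filter-[_] P? []
  length-filter-boxVecs (suc t) s P? =
    trans (length-filter-concatMap P? (λ i → List.map (+ suc i ∷_) (boxVecs t s)) (λ i → i) s)
          (Σ<-cong s (λ i _ → trans (length-filter-map P? (+ suc i ∷_) (boxVecs t s)) (length-filter-boxVecs t s (λ ξ → P? (+ suc i ∷ ξ)))))

  -- rhoPlus counts over {1, …, s}^t, countBox over {0, …, s − 1}^t; they agree because s ≡ 0 modulo s.
  rhoPlus≡countBox : ∀ {t} (Q : Poly t) s → rhoPlus Q s ≡ countBox (+ s) Q s
  rhoPlus≡countBox {t} Q s = begin
    rhoPlus Q s
      ≡⟨ length-filter-boxVecs t s (λ ξ → s ℕ.∣? ∣ eval Q ξ ∣) ⟩
    Σbox t s (λ ξ → 𝟙 (s ℕ.∣? ∣ eval Q (map (λ i → + suc i) ξ) ∣))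
      ≡⟨ Σbox-cong t s (λ ξ → 𝟙-cong _ _ (λ s∣Q → ∣ᵤ⇒∣ (subst (λ v → s ℕ.∣ ∣ eval Q v ∣) (Vec.map-∘ +_ suc ξ) s∣Q))
                                           (λ s∣Q → subst (λ v → s ℕ.∣ ∣ eval Q v ∣) (sym (Vec.map-∘ +_ suc ξ)) (∣⇒∣ᵤ s∣Q))) ⟩
    Σbox t s (λ ξ → 𝟙 (+ s ∣? eval Q (map +_ (map suc ξ))))
      ≡⟨ Σbox-rotate {R = _≡_[mod s ]} (λ {a} → ≡[mod]-refl {s} {a}) s (m≡0[mod] s) t _ (𝟙-eval-respects s Q) ⟩
    countBox (+ s) Q s ∎
    where open ≡-Reasoning

  divide-content : ∀ {t} (Q : Poly t) d → d ℕ.∣ content Q →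
                   Σ[ Q' ∈ Poly t ] (∀ e → coeff Q e ≡ + d * coeff Q' e) × (∀ ξ → eval Q ξ ≡ + d * eval Q' ξ)
  divide-content {zero}  c        d d∣c with ∣ᵤ⇒∣ {+ d} {c} d∣c
  ... | divides q c≡qd = q , (λ { [] → trans c≡qd (*-comm q (+ d)) }) , (λ { [] → trans c≡qd (*-comm q (+ d)) })
  divide-content {suc t} []       d _   = [] , (λ { (_ ∷ _) → sym (*-zeroʳ (+ d)) }) , (λ { (_ ∷ _) → sym (*-zeroʳ (+ d)) })
  divide-content {suc t} (c ∷ cs) d d∣content
    with divide-content c d (ℕ.∣-trans d∣content (gcd[m,n]∣m (content c) (content cs)))
       | divide-content cs d (ℕ.∣-trans d∣content (gcd[m,n]∣n (content c) (content cs)))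
  ... | c' , c≡ , c[ξ]≡ | cs' , cs≡ , cs[ξ]≡ = c' ∷ cs' , coeff≡ , eval≡
    where
    coeff≡ : ∀ e → coeff (c ∷ cs) e ≡ + d * coeff (c' ∷ cs') e
    coeff≡ (zero  ∷ e) = c≡ e
    coeff≡ (suc k ∷ e) = cs≡ (k ∷ e)
    eval≡ : ∀ ξ → eval (c ∷ cs) ξ ≡ + d * eval (c' ∷ cs') ξ
    eval≡ (x ∷ ξ) = trans (cong₂ (λ a b → a + x * b) (c[ξ]≡ ξ) (cs[ξ]≡ (x ∷ ξ))) (identity (+ d) (eval c' ξ) x (eval cs' (x ∷ ξ)))
      where
      identity : ∀ d a x b → d * a + x * (d * b) ≡ d * (a + x * b)
      identity = solve-∀

  content-greatest : ∀ {t} (Q : Poly t) m → (∀ e → + m ∣ coeff Q e) → m ℕ.∣ content Q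
  content-greatest {zero}  c        m m∣Q = ∣⇒∣ᵤ (m∣Q [])
  content-greatest {suc t} []       m _   = ℕ.divides 0 refl
  content-greatest {suc t} (c ∷ cs) m m∣Q =
    gcd-greatest (content-greatest c m (λ e → m∣Q (0 ∷ e))) (content-greatest cs m (λ { (k ∷ e) → m∣Q (suc k ∷ e) }))

  TotalDeg≤-quotient : ∀ {t} c (Q Q' : Poly t) {g} → .{{NonZero c}} → (∀ e → coeff Q e ≡ c * coeff Q' e) → TotalDeg≤ Q g → TotalDeg≤ Q' g
  TotalDeg≤-quotient c Q Q' Q≡cQ' deg e Q'[e]≢0 =
    deg e (λ Q[e]≡0 → Q'[e]≢0 (*-cancelˡ-≡ c _ (+ 0) (trans (sym (Q≡cQ' e)) (trans Q[e]≡0 (sym (*-zeroʳ c))))))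

  module Padic (p : ℕ) (p-prime : Prime p) where

    -- Roots modulo p, with multiplicity

    P : ℤ
    P = + p

    instance
      p-nonZero : ℕ.NonZero p
      p-nonZero = prime⇒nonZero p-prime

    P∣*⇒P∣⊎P∣ : ∀ a b → P ∣ a * b → (P ∣ a) ⊎ (P ∣ b)
    P∣*⇒P∣⊎P∣ a b P∣ab with euclidsLemma ∣ a ∣ ∣ b ∣ p-prime (subst (p ℕ.∣_) (abs-* a b) (∣⇒∣ᵤ P∣ab))
    ... | inj₁ p∣a = inj₁ (∣ᵤ⇒∣ p∣a)
    ... | inj₂ p∣b = inj₂ (∣ᵤ⇒∣ p∣b)

    P∤-distinct-residues : ∀ r n → r ℕ.< n → n ℕ.< p → ¬ P ∣ + r - + n
    P∤-distinct-residues r n r<n n<p P∣r-n = ℕ.<-irrefl refl (ℕ.<-≤-trans ∣r-n∣<p (ℕ.∣⇒≤ {{ℕ.>-nonZero ∣r-n∣>0}} (∣⇒∣ᵤ P∣r-n)))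
      where
      ∣r-n∣≡ : ∣ + r - + n ∣ ≡ n ℕ.∸ r
      ∣r-n∣≡ = trans (cong ∣_∣ (m-n≡m⊖n r n)) (∣⊖∣-< r<n)
      ∣r-n∣>0 : 0 ℕ.< ∣ + r - + n ∣
      ∣r-n∣>0 = subst (0 ℕ.<_) (sym ∣r-n∣≡) (ℕ.m<n⇒0<n∸m r<n)
      ∣r-n∣<p : ∣ + r - + n ∣ ℕ.< p
      ∣r-n∣<p = subst (ℕ._< p) (sym ∣r-n∣≡) (ℕ.≤-<-trans (ℕ.m∸n≤m n r) n<p)

    Unit : ℤ → Set
    Unit x = ¬ P ∣ x

    -- ord_b (f mod p) ≥ e
    Ord≥ : ∀ {n} → ℕ → Vec ℤ n → ℤ → Set
    Ord≥ e f b = AllBelow (P ∣_) e (taylor f b)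

    first-unit : ∀ {n} (v : Vec ℤ n) → ¬ P ∣ᵥ v → ∃[ m ] AllBelow (P ∣_) m v × At Unit m v
    first-unit []      P∤v = ⊥-elim (P∤v [])
    first-unit (x ∷ v) P∤v with P ∣? x
    ... | no  P∤x = 0 , tt , P∤x
    ... | yes P∣x with first-unit v (λ P∣v → P∤v (P∣x ∷ P∣v))
    ...   | m , below , unit = suc m , (P∣x , below) , unit

    AllBelow-mulLinear : ∀ {n} e r c (w : Vec ℤ n) → AllBelow (P ∣_) e (addConst r (mulLinear c w)) → P ∣ r → ¬ P ∣ c →
                         AllBelow (P ∣_) e w
    AllBelow-mulLinear zero    r c w        _                _   _   = tt
    AllBelow-mulLinear (suc e) r c []       _                _   _   = tt
    AllBelow-mulLinear (suc e) r c (w₀ ∷ w) (P∣r+cw₀ , below) P∣r P∤c with P∣*⇒P∣⊎P∣ c w₀ (∣m+n∣m⇒∣n P∣r+cw₀ P∣r)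
    ... | inj₁ P∣c  = ⊥-elim (P∤c P∣c)
    ... | inj₂ P∣w₀ = P∣w₀ , AllBelow-mulLinear e w₀ c w below P∣w₀ P∤c

    -- deflated is f divided e times by X − b, so f ≡ (X − b)^e · deflated modulo p.
    record Deflation {n} (f : Vec ℤ n) (b : ℤ) (e d : ℕ) : Set where
      field
        deflated  : Vec ℤ (n ℕ.∸ e)
        e≤d       : e ℕ.≤ d
        degree    : AllAbove (P ∣_) (d ℕ.∸ e) deflated
        nonzero   : ¬ P ∣ᵥ deflated
        keeps-ord : ∀ b' e' → ¬ P ∣ b' - b → Ord≥ e' f b' → Ord≥ e' deflated b'

    deflate : ∀ e {n} (f : Vec ℤ n) d b → Ord≥ e f b → ¬ P ∣ᵥ f → AllAbove (P ∣_) d f → Deflation f b e d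
    deflate zero    f d b _ P∤f deg = record
      { deflated = f ; e≤d = z≤n ; degree = deg ; nonzero = P∤f ; keeps-ord = λ _ _ _ ord → ord }
    deflate (suc e) {zero}  [] d b _ P∤f _ = ⊥-elim (P∤f [])
    deflate (suc e) {suc n} f@(_ ∷ _) d b (P∣f[b] , ord-q) P∤f deg = lower d deg
      where
      q = quot f b
      P∤q : ¬ P ∣ᵥ q
      P∤q P∣q = P∤f (∣ᵥ-quot⇒∣ᵥ f b P∣q P∣f[b])
      keeps-q : ∀ b' e' → ¬ P ∣ b' - b → Ord≥ e' f b' → Ord≥ e' q b'
      keeps-q b' e' P∤b'-b ord =
        AllBelow-mulLinear e' (eval₁ f b) (b' - b) (taylor q b') (subst (AllBelow (P ∣_) e') (taylor-quot f b b') ord) P∣f[b] P∤b'-b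
      lower : ∀ d → AllAbove (P ∣_) d f → Deflation f b (suc e) d
      lower zero    deg = ⊥-elim (P∤q (∣ᵥ-quot f b deg))
      lower (suc d) deg = record
        { deflated  = deflated
        ; e≤d       = s≤s e≤d
        ; degree    = degree
        ; nonzero   = nonzero
        ; keeps-ord = λ b' e' P∤b'-b ord → keeps-ord b' e' P∤b'-b (keeps-q b' e' P∤b'-b ord)
        }
        where open Deflation (deflate e q d b ord-q P∤q (AllAbove-quot d f b deg))

    Σ<-ord≤deg : ∀ n → n ℕ.≤ p → ∀ {k} (f : Vec ℤ k) d (m : ℕ → ℕ) → (∀ r → r ℕ.< n → Ord≥ (m r) f (+ r)) →
                 ¬ P ∣ᵥ f → AllAbove (P ∣_) d f → Σ< m n ℕ.≤ d
    Σ<-ord≤deg zero    _     f d m _   _   _   = z≤n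
    Σ<-ord≤deg (suc n) 1+n≤p f d m ord P∤f deg = begin
      Σ< m n ℕ.+ m n          ≤⟨ ℕ.+-monoˡ-≤ (m n) rest ⟩
      d ℕ.∸ m n ℕ.+ m n       ≡⟨ ℕ.m∸n+n≡m e≤d ⟩
      d                       ∎
      where
      open ℕ.≤-Reasoning
      open Deflation (deflate (m n) f d (+ n) (ord n ℕ.≤-refl) P∤f deg)
      rest : Σ< m n ℕ.≤ d ℕ.∸ m n
      rest = Σ<-ord≤deg n (ℕ.<⇒≤ 1+n≤p) deflated (d ℕ.∸ m n) m
        (λ r r<n → keeps-ord (+ r) (m r) (P∤-distinct-residues r n r<n 1+n≤p) (ord r (ℕ.m<n⇒m<1+n r<n))) nonzero degree

    -- Roots modulo p^ν of polynomials in one variable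

    P^ : ℕ → ℤ
    P^ k = + (p ℕ.^ k)

    P^-nonZero : ∀ k → NonZero (P^ k)
    P^-nonZero k = ℕ.m^n≢0 p k

    P^-+ : ∀ a b → P^ (a ℕ.+ b) ≡ P^ a * P^ b
    P^-+ a b = trans (cong +_ (ℕ.^-distribˡ-+-* p a b)) (pos-* (p ℕ.^ a) (p ℕ.^ b))

    P^-suc : ∀ k → P^ (suc k) ≡ P * P^ k
    P^-suc k = pos-* p (p ℕ.^ k)

    P^-∣ : ∀ {a b} → a ℕ.≤ b → P^ a ∣ P^ b
    P^-∣ {a} {b} a≤b = divides (P^ (b ℕ.∸ a)) (trans (cong P^ (sym (ℕ.m∸n+n≡m a≤b))) (P^-+ (b ℕ.∸ a) a))

    P∣P^suc : ∀ k → P ∣ P^ (suc k)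
    P∣P^suc k = divides (P^ k) (trans (P^-suc k) (*-comm P (P^ k)))

    P^-1 : P^ 1 ≡ P
    P^-1 = cong +_ (ℕ.*-identityʳ p)

    -- min B (the valuation at p of the content of v)
    cappedVal : ∀ {n} → ℕ → Vec ℤ n → ℕ
    cappedVal zero    v = 0
    cappedVal (suc B) v with P^ (suc B) ∣ᵥ? v
    ... | yes _ = suc B
    ... | no  _ = cappedVal B v

    cappedVal-≤ : ∀ {n} B (v : Vec ℤ n) → cappedVal B v ℕ.≤ B
    cappedVal-≤ zero    v = z≤n
    cappedVal-≤ (suc B) v with P^ (suc B) ∣ᵥ? v
    ... | yes _ = ℕ.≤-refl
    ... | no  _ = ℕ.m≤n⇒m≤1+n (cappedVal-≤ B v)

    cappedVal-∣ᵥ : ∀ {n} B (v : Vec ℤ n) → P^ (cappedVal B v) ∣ᵥ v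
    cappedVal-∣ᵥ zero    v = 1∣ᵥ v
    cappedVal-∣ᵥ (suc B) v with P^ (suc B) ∣ᵥ? v
    ... | yes P^B∣v = P^B∣v
    ... | no  _     = cappedVal-∣ᵥ B v

    cappedVal-maximal : ∀ {n} B (v : Vec ℤ n) → cappedVal B v ℕ.< B → ¬ P^ (suc (cappedVal B v)) ∣ᵥ v
    cappedVal-maximal (suc B) v capped<1+B with P^ (suc B) ∣ᵥ? v
    ... | yes _ = ⊥-elim (ℕ.<-irrefl refl capped<1+B)
    ... | no P^1+B∤v with ℕ.m≤n⇒m<n∨m≡n (ℕ.≤-pred capped<1+B)
    ...   | inj₁ capped<B = cappedVal-maximal B v capped<B
    ...   | inj₂ capped≡B rewrite capped≡B = P^1+B∤v

    primitive-part : ∀ {n} k (h : Vec ℤ n) → P^ k ∣ᵥ h → ¬ P^ (suc k) ∣ᵥ h → Σ[ u ∈ Vec ℤ n ] h ≡ map (P^ k *_) u × ¬ P ∣ᵥ u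
    primitive-part k h P^k∣h P^1+k∤h with ∣ᵥ⇒map-* (P^ k) h P^k∣h
    ... | u , h≡ = u , h≡ , λ P∣u → P^1+k∤h (subst₂ _∣ᵥ_ P^k*P≡P^1+k (sym h≡) (∣ᵥ-map-* (P^ k) P u P∣u))
      where
      P^k*P≡P^1+k : P^ k * P ≡ P^ (suc k)
      P^k*P≡P^1+k = trans (*-comm (P^ k) P) (sym (P^-suc k))

    roots : ∀ {n} → Vec ℤ n → ℕ → ℕ
    roots f ν = count∣ (P^ ν) (λ i → eval₁ f (+ i)) (p ℕ.^ ν)

    roots-map-* : ∀ {n} k x (u : Vec ℤ n) K →
      count∣ (P^ (k ℕ.+ x)) (λ i → eval₁ (map (P^ k *_) u) (+ i)) (p ℕ.^ x ℕ.* K) ≡ K ℕ.* roots u x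
    roots-map-* k x u K = begin
      count∣ (P^ (k ℕ.+ x)) (λ i → eval₁ (map (P^ k *_) u) (+ i)) (p ℕ.^ x ℕ.* K)
        ≡⟨ cong (λ m → count∣ m _ (p ℕ.^ x ℕ.* K)) (P^-+ k x) ⟩
      count∣ (P^ k * P^ x) (λ i → eval₁ (map (P^ k *_) u) (+ i)) (p ℕ.^ x ℕ.* K)
        ≡⟨ count∣-*-cancel (P^ k) (P^ x) (p ℕ.^ x ℕ.* K) {{P^-nonZero k}} (λ i → eval₁-map-* (P^ k) u (+ i)) ⟩
      count∣ (P^ x) (λ i → eval₁ u (+ i)) (p ℕ.^ x ℕ.* K)
        ≡⟨ count∣-eval₁-periodic u (p ℕ.^ x) K ⟩
      K ℕ.* roots u x ∎
      where open ≡-Reasoning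

    P∤eval₁-dilate : ∀ {n} (T : Vec ℤ n) y → At Unit 0 T → ¬ P ∣ eval₁ (dilate P T) y
    P∤eval₁-dilate (x ∷ v) y P∤x P∣h[y] =
      P∤x (∣m+n∣n⇒∣m P∣h[y] (∣n⇒∣m*n y (∣ᵥ⇒∣eval₁ y (∣ᵥ-map-*ˡ P (dilate P v)))))

    P∣ᵥ-dilate : ∀ {n} m (T : Vec ℤ n) → AllBelow (P ∣_) (suc m) T → P ∣ᵥ dilate P T
    P∣ᵥ-dilate m []      _         = []
    P∣ᵥ-dilate m (x ∷ v) (P∣x , _) = P∣x ∷ ∣ᵥ-map-*ˡ P (dilate P v)

    P^∤ᵥ-dilate : ∀ {n} m (T : Vec ℤ n) → At Unit m T → ¬ P^ (suc m) ∣ᵥ dilate P T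
    P^∤ᵥ-dilate zero    (x ∷ v) P∤x     (P^1∣x ∷ _) = P∤x (subst (_∣ x) P^-1 P^1∣x)
    P^∤ᵥ-dilate (suc m) (x ∷ v) unit-at (_ ∷ P^2+m∣Pv) =
      P^∤ᵥ-dilate m v unit-at (∣ᵥ-map-*-cancel P (P^ (suc m)) (dilate P v) (subst (_∣ᵥ map (P *_) (dilate P v)) (P^-suc (suc m)) P^2+m∣Pv))

    -- the coefficient of Yʲ in dilate P T is Pʲ times that of T
    AllAbove-dilate : ∀ {n} k (T : Vec ℤ n) → AllAbove (P^ (suc k) ∣_) k (dilate P T)
    AllAbove-dilate k       []      = tt
    AllAbove-dilate zero    (x ∷ v) = subst (_∣ᵥ map (P *_) (dilate P v)) (sym P^-1) (∣ᵥ-map-*ˡ P (dilate P v))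
    AllAbove-dilate (suc k) (x ∷ v) =
      subst (λ c → AllAbove (c ∣_) k (map (P *_) (dilate P v))) (sym (P^-suc (suc k))) (AllAbove-map-* P (P^ (suc k)) k (dilate P v) (AllAbove-dilate k v))

    eval₁-dilate-taylor : ∀ {n} (f : Vec ℤ n) r y → eval₁ f (+ (r ℕ.+ p ℕ.* y)) ≡ eval₁ (dilate P (taylor f (+ r))) (+ y)
    eval₁-dilate-taylor f r y = begin
      eval₁ f (+ (r ℕ.+ p ℕ.* y))                ≡⟨ cong (eval₁ f) (trans (pos-+ r (p ℕ.* y)) (cong (λ z → + r + z) (pos-* p y))) ⟩
      eval₁ f (+ r + P * + y)                    ≡⟨ eval₁-taylor f (+ r) (P * + y) ⟨
      eval₁ (taylor f (+ r)) (P * + y)           ≡⟨ eval₁-dilate P (taylor f (+ r)) (+ y) ⟨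
      eval₁ (dilate P (taylor f (+ r))) (+ y)    ∎
      where open ≡-Reasoning

    -- lifts (taylor f r) ν counts the roots of f modulo p^(1+ν) that are ≡ r modulo p.
    lifts : ∀ {n} → Vec ℤ n → ℕ → ℕ
    lifts T ν = count∣ (P^ (suc ν)) (λ y → eval₁ (dilate P T) (+ y)) (p ℕ.^ ν)

    roots-suc : ∀ {n} (f : Vec ℤ n) ν → roots f (suc ν) ≡ Σ< (λ r → lifts (taylor f (+ r)) ν) p
    roots-suc f ν = trans (Σ<-* _ p (p ℕ.^ ν))
      (Σ<-cong p (λ r _ → Σ<-cong (p ℕ.^ ν) (λ y _ → cong (λ z → 𝟙 (P^ (suc ν) ∣? z)) (eval₁-dilate-taylor f r y))))

    RootBound : ℕ → ℕ → Set
    RootBound G ν = ∀ {n} (f : Vec ℤ n) d → d ℕ.≤ G → ¬ P ∣ᵥ f → AllAbove (P ∣_) d f →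
                    roots f ν ℕ.^ G ℕ.≤ d ℕ.^ G ℕ.* p ℕ.^ (ν ℕ.* (G ℕ.∸ 1))

    lifts-none : ∀ {n} (T : Vec ℤ n) ν → At Unit 0 T → lifts T ν ≡ 0
    lifts-none T ν unit = count∣-none (P^ (suc ν)) (λ y → eval₁ (dilate P T) (+ y)) (p ℕ.^ ν)
      (λ y P^1+ν∣h[y] → P∤eval₁-dilate T (+ y) unit (∣-trans (P∣P^suc ν) P^1+ν∣h[y]))

    lifts-all : ∀ {n} (T : Vec ℤ n) ν → P^ (suc ν) ∣ᵥ dilate P T → lifts T ν ≡ p ℕ.^ ν
    lifts-all T ν P^1+ν∣h = count∣-all (P^ (suc ν)) (λ y → eval₁ (dilate P T) (+ y)) (p ℕ.^ ν) (λ y → ∣ᵥ⇒∣eval₁ (+ y) P^1+ν∣h)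

    lifts-primitive : ∀ {n} (T : Vec ℤ n) k w u → dilate P T ≡ map (P^ (suc k) *_) u → lifts T (k ℕ.+ w) ≡ p ℕ.^ k ℕ.* roots u w
    lifts-primitive T k w u h≡ = begin
      lifts T (k ℕ.+ w)
        ≡⟨ cong (λ h → count∣ (P^ (suc k ℕ.+ w)) (λ y → eval₁ h (+ y)) (p ℕ.^ (k ℕ.+ w))) h≡ ⟩
      count∣ (P^ (suc k ℕ.+ w)) (λ y → eval₁ (map (P^ (suc k) *_) u) (+ y)) (p ℕ.^ (k ℕ.+ w))
        ≡⟨ cong (count∣ _ _) p^[k+w]≡ ⟩
      count∣ (P^ (suc k ℕ.+ w)) (λ y → eval₁ (map (P^ (suc k) *_) u) (+ y)) (p ℕ.^ w ℕ.* p ℕ.^ k)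
        ≡⟨ roots-map-* (suc k) w u (p ℕ.^ k) ⟩
      p ℕ.^ k ℕ.* roots u w
        ∎
      where
      open ≡-Reasoning
      p^[k+w]≡ : p ℕ.^ (k ℕ.+ w) ≡ p ℕ.^ w ℕ.* p ℕ.^ k
      p^[k+w]≡ = trans (ℕ.^-distribˡ-+-* p k w) (ℕ.*-comm (p ℕ.^ k) (p ℕ.^ w))

    lifts-bound-primitive : ∀ G → 1 ℕ.≤ G → ∀ k w → RootBound G w → ∀ {n} (T : Vec ℤ n) m → suc k ℕ.≤ m → m ℕ.≤ G →
                            P^ (suc k) ∣ᵥ dilate P T → ¬ P^ (suc (suc k)) ∣ᵥ dilate P T →
                            lifts T (k ℕ.+ w) ℕ.^ G ℕ.≤ m ℕ.^ G ℕ.* p ℕ.^ (suc (k ℕ.+ w) ℕ.* (G ℕ.∸ 1))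
    lifts-bound-primitive G G≥1 k w bound T m 1+k≤m m≤G P^1+k∣h P^2+k∤h with primitive-part (suc k) (dilate P T) P^1+k∣h P^2+k∤h
    ... | u , h≡ , P∤u = begin
      lifts T (k ℕ.+ w) ℕ.^ G                                                  ≡⟨ cong (ℕ._^ G) (lifts-primitive T k w u h≡) ⟩
      (p ℕ.^ k ℕ.* roots u w) ℕ.^ G                                            ≡⟨ ^-distribʳ-* (p ℕ.^ k) (roots u w) G ⟩
      (p ℕ.^ k) ℕ.^ G ℕ.* roots u w ℕ.^ G                                      ≤⟨ ℕ.*-monoʳ-≤ ((p ℕ.^ k) ℕ.^ G) (bound u (suc k) 1+k≤G P∤u deg-u) ⟩
      (p ℕ.^ k) ℕ.^ G ℕ.* (suc k ℕ.^ G ℕ.* p ℕ.^ (w ℕ.* (G ℕ.∸ 1)))            ≡⟨ rearrange ⟩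
      suc k ℕ.^ G ℕ.* p ℕ.^ (k ℕ.* G ℕ.+ w ℕ.* (G ℕ.∸ 1))                      ≤⟨ ℕ.*-mono-≤ (ℕ.^-monoˡ-≤ G 1+k≤m) (ℕ.^-monoʳ-≤ p (exponent-bound k w G 1+k≤G)) ⟩
      m ℕ.^ G ℕ.* p ℕ.^ ((w ℕ.+ suc k) ℕ.* (G ℕ.∸ 1))                          ≡⟨ cong (λ e → m ℕ.^ G ℕ.* p ℕ.^ (e ℕ.* (G ℕ.∸ 1))) (ℕ.+-comm w (suc k)) ⟩
      m ℕ.^ G ℕ.* p ℕ.^ (suc (k ℕ.+ w) ℕ.* (G ℕ.∸ 1))                          ∎
      where
      open ℕ.≤-Reasoning
      1+k≤G = ℕ.≤-trans 1+k≤m m≤G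
      deg-u : AllAbove (P ∣_) (suc k) u
      deg-u = AllAbove-map-*-cancel (P^ (suc k)) P (suc k) u {{P^-nonZero (suc k)}}
        (subst₂ (λ c → AllAbove (c ∣_) (suc k)) (trans (P^-suc (suc k)) (*-comm P (P^ (suc k)))) h≡ (AllAbove-dilate (suc k) T))
      rearrange : (p ℕ.^ k) ℕ.^ G ℕ.* (suc k ℕ.^ G ℕ.* p ℕ.^ (w ℕ.* (G ℕ.∸ 1))) ≡ suc k ℕ.^ G ℕ.* p ℕ.^ (k ℕ.* G ℕ.+ w ℕ.* (G ℕ.∸ 1))
      rearrange = begin-equality
        (p ℕ.^ k) ℕ.^ G ℕ.* (suc k ℕ.^ G ℕ.* p ℕ.^ (w ℕ.* (G ℕ.∸ 1)))   ≡⟨ cong (ℕ._* (suc k ℕ.^ G ℕ.* p ℕ.^ (w ℕ.* (G ℕ.∸ 1)))) (ℕ.^-*-assoc p k G) ⟩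
        p ℕ.^ (k ℕ.* G) ℕ.* (suc k ℕ.^ G ℕ.* p ℕ.^ (w ℕ.* (G ℕ.∸ 1)))   ≡⟨ x∙yz≈y∙xz (p ℕ.^ (k ℕ.* G)) (suc k ℕ.^ G) _ ⟩
        suc k ℕ.^ G ℕ.* (p ℕ.^ (k ℕ.* G) ℕ.* p ℕ.^ (w ℕ.* (G ℕ.∸ 1)))   ≡⟨ cong (suc k ℕ.^ G ℕ.*_) (ℕ.^-distribˡ-+-* p (k ℕ.* G) _) ⟨
        suc k ℕ.^ G ℕ.* p ℕ.^ (k ℕ.* G ℕ.+ w ℕ.* (G ℕ.∸ 1))             ∎

    lifts-bound-full : ∀ G {n} (T : Vec ℤ n) ν m → suc ν ℕ.≤ m → m ℕ.≤ G → P^ (suc ν) ∣ᵥ dilate P T →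
                       lifts T ν ℕ.^ G ℕ.≤ m ℕ.^ G ℕ.* p ℕ.^ (suc ν ℕ.* (G ℕ.∸ 1))
    lifts-bound-full G T ν m 1+ν≤m m≤G P^1+ν∣h = begin
      lifts T ν ℕ.^ G         ≡⟨ cong (ℕ._^ G) (lifts-all T ν P^1+ν∣h) ⟩
      (p ℕ.^ ν) ℕ.^ G         ≡⟨ ℕ.^-*-assoc p ν G ⟩
      p ℕ.^ (ν ℕ.* G)         ≡⟨ cong (p ℕ.^_) (ℕ.+-identityʳ (ν ℕ.* G)) ⟨
      p ℕ.^ (ν ℕ.* G ℕ.+ 0)   ≤⟨ ℕ.^-monoʳ-≤ p (exponent-bound ν 0 G (ℕ.≤-trans 1+ν≤m m≤G)) ⟩
      X                       ≤⟨ ℕ.m≤n*m X (m ℕ.^ G) {{ℕ.m^n≢0 m G {{ℕ.>-nonZero (ℕ.<-≤-trans ℕ.z<s 1+ν≤m)}}}} ⟩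
      m ℕ.^ G ℕ.* X           ∎
      where
      open ℕ.≤-Reasoning
      X = p ℕ.^ (suc ν ℕ.* (G ℕ.∸ 1))

    lifts-bound : ∀ G → 1 ℕ.≤ G → ∀ ν → (∀ w → 1 ℕ.≤ w → w ℕ.≤ ν → RootBound G w) →
                  ∀ {n} (T : Vec ℤ n) m → AllBelow (P ∣_) m T → At Unit m T → m ℕ.≤ G →
                  lifts T ν ℕ.^ G ℕ.≤ m ℕ.^ G ℕ.* p ℕ.^ (suc ν ℕ.* (G ℕ.∸ 1))
    lifts-bound G G≥1 ν IH T zero    _     unit m≤G =
      ℕ.≤-trans (ℕ.≤-reflexive (trans (cong (ℕ._^ G) (lifts-none T ν unit)) (0^-pos G G≥1))) z≤n
    lifts-bound G G≥1 ν IH T (suc m) below unit m≤G =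
      by-valuation (cappedVal (suc ν) h) (cappedVal-≤ (suc ν) h) (cappedVal-∣ᵥ (suc ν) h) (cappedVal-maximal (suc ν) h)
      where
      h = dilate P T
      k≤1+m : ∀ {k} → P^ k ∣ᵥ h → k ℕ.≤ suc m
      k≤1+m {k} P^k∣h with k ℕ.≤? suc m
      ... | yes k≤1+m = k≤1+m
      ... | no  k≰1+m = ⊥-elim (P^∤ᵥ-dilate (suc m) T unit (∣-∣ᵥ-trans (P^-∣ (ℕ.≰⇒> k≰1+m)) P^k∣h))
      partial : ∀ k → k ℕ.< suc ν → P^ k ∣ᵥ h → ¬ P^ (suc k) ∣ᵥ h → lifts T ν ℕ.^ G ℕ.≤ suc m ℕ.^ G ℕ.* p ℕ.^ (suc ν ℕ.* (G ℕ.∸ 1))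
      partial zero    _       _       P^1∤h   = ⊥-elim (P^1∤h (subst (_∣ᵥ h) (sym P^-1) (P∣ᵥ-dilate m T below)))
      partial (suc k) 1+k<1+ν P^1+k∣h P^2+k∤h =
        subst (λ ν → lifts T ν ℕ.^ G ℕ.≤ suc m ℕ.^ G ℕ.* p ℕ.^ (suc ν ℕ.* (G ℕ.∸ 1))) (ℕ.m+[n∸m]≡n (ℕ.<⇒≤ k<ν))
          (lifts-bound-primitive G G≥1 k (ν ℕ.∸ k) (IH (ν ℕ.∸ k) (ℕ.m<n⇒0<n∸m k<ν) (ℕ.m∸n≤m ν k)) T (suc m) (k≤1+m P^1+k∣h) m≤G P^1+k∣h P^2+k∤h)
        where k<ν = ℕ.≤-pred 1+k<1+ν
      by-valuation : ∀ k → k ℕ.≤ suc ν → P^ k ∣ᵥ h → (k ℕ.< suc ν → ¬ P^ (suc k) ∣ᵥ h) →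
                     lifts T ν ℕ.^ G ℕ.≤ suc m ℕ.^ G ℕ.* p ℕ.^ (suc ν ℕ.* (G ℕ.∸ 1))
      by-valuation k k≤1+ν P^k∣h maximal with ℕ.m≤n⇒m<n∨m≡n k≤1+ν
      ... | inj₂ refl  = lifts-bound-full G T ν (suc m) (k≤1+m P^k∣h) m≤G P^k∣h
      ... | inj₁ k<1+ν = partial k k<1+ν P^k∣h (maximal k<1+ν)

    roots-bound : ∀ G → 1 ℕ.≤ G → ∀ ν → 1 ℕ.≤ ν → RootBound G ν
    roots-bound G G≥1 = <-rec (λ ν → 1 ℕ.≤ ν → RootBound G ν) step
      where
      step : ∀ ν → (∀ {w} → w ℕ.< ν → 1 ℕ.≤ w → RootBound G w) → 1 ℕ.≤ ν → RootBound G ν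
      step (suc ν) IH _ f d d≤G P∤f deg = begin
        roots f (suc ν) ℕ.^ G                         ≡⟨ cong (ℕ._^ G) (roots-suc f ν) ⟩
        Σ< (λ r → lifts (taylor f (+ r)) ν) p ℕ.^ G   ≤⟨ minkowski-Σ< G G≥1 _ m X p lifts-bounded ⟩
        Σ< m p ℕ.^ G ℕ.* X                            ≤⟨ ℕ.*-monoˡ-≤ X (ℕ.^-monoˡ-≤ G Σm≤d) ⟩
        d ℕ.^ G ℕ.* X                                 ∎
        where
        open ℕ.≤-Reasoning
        X = p ℕ.^ (suc ν ℕ.* (G ℕ.∸ 1))
        ord : ∀ r → ∃[ m ] AllBelow (P ∣_) m (taylor f (+ r)) × At Unit m (taylor f (+ r))
        ord r = first-unit (taylor f (+ r)) (¬∣ᵥ-taylor f (+ r) P∤f)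
        m : ℕ → ℕ
        m r = proj₁ (ord r)
        Σm≤d : Σ< m p ℕ.≤ d
        Σm≤d = Σ<-ord≤deg p ℕ.≤-refl f d m (λ r _ → proj₁ (proj₂ (ord r))) P∤f deg
        lifts-bounded : ∀ r → r ℕ.< p → lifts (taylor f (+ r)) ν ℕ.^ G ℕ.≤ m r ℕ.^ G ℕ.* X
        lifts-bounded r r<p = lifts-bound G G≥1 ν (λ w 1≤w w≤ν → IH (s≤s w≤ν) 1≤w) (taylor f (+ r)) (m r)
          (proj₁ (proj₂ (ord r))) (proj₂ (proj₂ (ord r))) (ℕ.≤-trans (Σ<-term-≤ m p r r<p) (ℕ.≤-trans Σm≤d d≤G))

    roots-bound-primitive : ∀ G → 1 ℕ.≤ G → ∀ w x → 1 ℕ.≤ x → ∀ {n} (q u : Vec ℤ n) → AllAbove (_≡ + 0) G q →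
                            q ≡ map (P^ w *_) u → ¬ P ∣ᵥ u →
                            roots q (w ℕ.+ x) ℕ.^ G ℕ.≤ G ℕ.^ G ℕ.* p ℕ.^ ((w ℕ.+ x) ℕ.* (G ℕ.∸ 1) ℕ.+ w)
    roots-bound-primitive G@(suc G') G≥1 w x 1≤x q u deg q≡ P∤u = begin
      roots q (w ℕ.+ x) ℕ.^ G                                   ≡⟨ cong (ℕ._^ G) roots-q ⟩
      (p ℕ.^ w ℕ.* roots u x) ℕ.^ G                             ≡⟨ ^-distribʳ-* (p ℕ.^ w) (roots u x) G ⟩
      (p ℕ.^ w) ℕ.^ G ℕ.* roots u x ℕ.^ G                       ≤⟨ ℕ.*-monoʳ-≤ ((p ℕ.^ w) ℕ.^ G) (roots-bound G G≥1 x 1≤x u G ℕ.≤-refl P∤u deg-u) ⟩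
      (p ℕ.^ w) ℕ.^ G ℕ.* (G ℕ.^ G ℕ.* p ℕ.^ (x ℕ.* G'))      ≡⟨ cong (ℕ._* (G ℕ.^ G ℕ.* p ℕ.^ (x ℕ.* G'))) (ℕ.^-*-assoc p w G) ⟩
      p ℕ.^ (w ℕ.* G) ℕ.* (G ℕ.^ G ℕ.* p ℕ.^ (x ℕ.* G'))      ≡⟨ x∙yz≈y∙xz (p ℕ.^ (w ℕ.* G)) (G ℕ.^ G) _ ⟩
      G ℕ.^ G ℕ.* (p ℕ.^ (w ℕ.* G) ℕ.* p ℕ.^ (x ℕ.* G'))      ≡⟨ cong (G ℕ.^ G ℕ.*_) (ℕ.^-distribˡ-+-* p (w ℕ.* G) (x ℕ.* G')) ⟨
      G ℕ.^ G ℕ.* p ℕ.^ (w ℕ.* G ℕ.+ x ℕ.* G')                ≡⟨ cong (λ e → G ℕ.^ G ℕ.* p ℕ.^ e) (exponent w x G') ⟩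
      G ℕ.^ G ℕ.* p ℕ.^ ((w ℕ.+ x) ℕ.* G' ℕ.+ w)              ∎
      where
      open ℕ.≤-Reasoning
      exponent : ∀ w x G' → w ℕ.* suc G' ℕ.+ x ℕ.* G' ≡ (w ℕ.+ x) ℕ.* G' ℕ.+ w
      exponent = ℕ-Solver.solve-∀
      roots-q : roots q (w ℕ.+ x) ≡ p ℕ.^ w ℕ.* roots u x
      roots-q = begin-equality
        roots q (w ℕ.+ x)                                                             ≡⟨ cong (λ q → roots q (w ℕ.+ x)) q≡ ⟩
        count∣ (P^ (w ℕ.+ x)) (λ i → eval₁ (map (P^ w *_) u) (+ i)) (p ℕ.^ (w ℕ.+ x))
          ≡⟨ cong (count∣ _ _) (trans (ℕ.^-distribˡ-+-* p w x) (ℕ.*-comm (p ℕ.^ w) (p ℕ.^ x))) ⟩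
        count∣ (P^ (w ℕ.+ x)) (λ i → eval₁ (map (P^ w *_) u) (+ i)) (p ℕ.^ x ℕ.* p ℕ.^ w) ≡⟨ roots-map-* w x u (p ℕ.^ w) ⟩
        p ℕ.^ w ℕ.* roots u x                                                         ∎
      deg-u : AllAbove (P ∣_) G u
      deg-u = AllAbove-map-*-cancel (P^ w) P G u {{P^-nonZero w}}
        (subst (AllAbove (P^ w * P ∣_) G) q≡ (AllAbove-map (λ { refl → divides (+ 0) refl }) G q deg))

    roots-bound-valuation : ∀ G → 1 ℕ.≤ G → ∀ ν → 1 ℕ.≤ ν → ∀ {n} (q : Vec ℤ n) w → AllAbove (_≡ + 0) G q →
                          w ℕ.≤ ν → P^ w ∣ᵥ q → (w ℕ.< ν → ¬ P^ (suc w) ∣ᵥ q) →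
                          roots q ν ℕ.^ G ℕ.≤ G ℕ.^ G ℕ.* p ℕ.^ (ν ℕ.* (G ℕ.∸ 1) ℕ.+ w)
    roots-bound-valuation G@(suc G') G≥1 ν 1≤ν q w deg w≤ν P^w∣q maximal with ℕ.m≤n⇒m<n∨m≡n w≤ν
    ... | inj₂ refl = begin
      roots q w ℕ.^ G                     ≤⟨ ℕ.^-monoˡ-≤ G (count∣-≤ (P^ w) _ (p ℕ.^ w)) ⟩
      (p ℕ.^ w) ℕ.^ G                     ≡⟨ ℕ.^-*-assoc p w G ⟩
      p ℕ.^ (w ℕ.* G)                     ≡⟨ cong (p ℕ.^_) (trans (ℕ.*-suc w G') (ℕ.+-comm w (w ℕ.* G'))) ⟩
      p ℕ.^ (w ℕ.* G' ℕ.+ w)              ≤⟨ ℕ.m≤n*m _ (G ℕ.^ G) {{ℕ.m^n≢0 G G}} ⟩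
      G ℕ.^ G ℕ.* p ℕ.^ (w ℕ.* G' ℕ.+ w)  ∎
      where open ℕ.≤-Reasoning
    ... | inj₁ w<ν with primitive-part w q P^w∣q (maximal w<ν)
    ...   | u , q≡ , P∤u = subst (λ ν → roots q ν ℕ.^ G ℕ.≤ G ℕ.^ G ℕ.* p ℕ.^ (ν ℕ.* G' ℕ.+ w)) (ℕ.m+[n∸m]≡n w≤ν)
            (roots-bound-primitive G G≥1 w (ν ℕ.∸ w) (ℕ.m<n⇒0<n∸m w<ν) q u deg q≡ P∤u)

    -- Zeros modulo p^ν of polynomials in several variables

    zeros : ∀ {t} → Poly t → ℕ → ℕ
    zeros Q ν = countBox (P^ ν) Q (p ℕ.^ ν)

    zeros-fiber : ∀ {t} (cs : List (Poly t)) ν → zeros cs ν ≡ Σbox t (p ℕ.^ ν) (λ ξ → roots (fiber cs (map +_ ξ)) ν)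
    zeros-fiber cs ν = countBox-fiber (P^ ν) cs (p ℕ.^ ν)

    zeros-periodic : ∀ {t} (Q : Poly t) j K → countBox (P^ j) Q (p ℕ.^ j ℕ.* K) ≡ K ℕ.^ t ℕ.* zeros Q j
    zeros-periodic Q j K = countBox-periodic (p ℕ.^ j) Q K

    Primitive : ∀ {t} → Poly t → Set
    Primitive {t} Q = ∃[ e ] Unit (coeff {t} Q e)

    all-or-unit : ∀ {t} (Q : Poly t) → (∀ e → P ∣ coeff Q e) ⊎ Primitive Q
    all-or-unit {zero} c with P ∣? c
    ... | yes P∣c = inj₁ (λ { [] → P∣c })
    ... | no  P∤c = inj₂ ([] , P∤c)
    all-or-unit {suc t} []       = inj₁ (λ { (k ∷ e) → divides (+ 0) refl })
    all-or-unit {suc t} (c ∷ cs) with all-or-unit c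
    ... | inj₂ (e , unit) = inj₂ (0 ∷ e , unit)
    ... | inj₁ P∣c with all-or-unit cs
    ...   | inj₂ (k ∷ e , unit) = inj₂ (suc k ∷ e , unit)
    ...   | inj₁ P∣cs           = inj₁ (λ { (zero ∷ e) → P∣c e ; (suc k ∷ e) → P∣cs (k ∷ e) })

    ZerosBound : ℕ → Set
    ZerosBound t = ∀ (Q : Poly (suc t)) G ν → 1 ℕ.≤ G → TotalDeg≤ Q G → Primitive Q →
                   zeros Q ν ℕ.^ G ℕ.≤ G ℕ.^ (suc t ℕ.* G) ℕ.* suc ν ℕ.^ (t ℕ.* G) ℕ.* p ℕ.^ (ν ℕ.* (suc t ℕ.* G ℕ.∸ 1))

    zeros-bound-at-0 : ∀ {t} (Q : Poly t) G a c → 1 ℕ.≤ G → zeros Q 0 ℕ.^ G ℕ.≤ G ℕ.^ a ℕ.* 1 ℕ.^ c ℕ.* 1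
    zeros-bound-at-0 {t} Q G a c G≥1 = begin
      zeros Q 0 ℕ.^ G           ≤⟨ ℕ.^-monoˡ-≤ G (ℕ.≤-trans (countBox-≤ (P^ 0) Q 1) (ℕ.≤-reflexive (ℕ.^-zeroˡ t))) ⟩
      1 ℕ.^ G                   ≡⟨ ℕ.^-zeroˡ G ⟩
      1                         ≤⟨ ℕ.*-mono-≤ (ℕ.*-mono-≤ (ℕ.m^n>0 G {{ℕ.>-nonZero G≥1}} a) (ℕ.≤-reflexive (sym (ℕ.^-zeroˡ c)))) (ℕ.≤-refl {1}) ⟩
      G ℕ.^ a ℕ.* 1 ℕ.^ c ℕ.* 1 ∎
      where open ℕ.≤-Reasoning

    ¬Unit-0 : ¬ Unit (+ 0)
    ¬Unit-0 P∤0 = P∤0 (divides (+ 0) refl)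

    zeros-bound-univariate : ZerosBound 0
    zeros-bound-univariate Q G zero        G≥1 deg prim = zeros-bound-at-0 Q G (1 ℕ.* G) (0 ℕ.* G) G≥1
    zeros-bound-univariate Q G ν@(suc _) G≥1 deg (k ∷ [] , unit) with coeff-∈ {A = Unit} Q k [] ¬Unit-0 unit
    ... | c , c∈Q , unit-c = begin
      zeros Q ν ℕ.^ G                                                   ≡⟨ cong (ℕ._^ G) (zeros-fiber Q ν) ⟩
      roots (fiber Q []) ν ℕ.^ G
        ≤⟨ roots-bound-valuation G G≥1 ν (s≤s z≤n) (fiber Q []) 0 (fiber-deg G Q [] deg) z≤n (1∣ᵥ _) fiber-primitive ⟩
      G ℕ.^ G ℕ.* p ℕ.^ (ν ℕ.* (G ℕ.∸ 1) ℕ.+ 0)                         ≡⟨ cong (λ e → G ℕ.^ G ℕ.* p ℕ.^ e) (ℕ.+-identityʳ (ν ℕ.* (G ℕ.∸ 1))) ⟩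
      G ℕ.^ G ℕ.* p ℕ.^ (ν ℕ.* (G ℕ.∸ 1))                               ≡⟨ cong (ℕ._* p ℕ.^ (ν ℕ.* (G ℕ.∸ 1))) (ℕ.*-identityʳ (G ℕ.^ G)) ⟨
      G ℕ.^ G ℕ.* 1 ℕ.* p ℕ.^ (ν ℕ.* (G ℕ.∸ 1))                         ≡⟨ cong (λ g → G ℕ.^ g ℕ.* 1 ℕ.* p ℕ.^ (ν ℕ.* (g ℕ.∸ 1))) (ℕ.*-identityˡ G) ⟨
      G ℕ.^ (1 ℕ.* G) ℕ.* 1 ℕ.* p ℕ.^ (ν ℕ.* (1 ℕ.* G ℕ.∸ 1))           ∎
      where
      open ℕ.≤-Reasoning
      fiber-primitive : 0 ℕ.< ν → ¬ P^ 1 ∣ᵥ fiber Q []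
      fiber-primitive _ P^1∣fiber = unit-c (subst (_∣ c) P^-1 (∣ᵥ-fiber-∈ [] c∈Q P^1∣fiber))

    module Slices {t} (Q : Poly (suc t)) (ν : ℕ) where

      fib : Vec ℕ t → Vec ℤ (length Q)
      fib ξ = fiber Q (map +_ ξ)

      fibVal : Vec ℕ t → ℕ
      fibVal ξ = cappedVal ν (fib ξ)

      slice : ℕ → ℕ
      slice j = Σbox t (p ℕ.^ ν) (λ ξ → 𝟙 (fibVal ξ ℕ.≟ j) ℕ.* roots (fib ξ) ν)

      members : ℕ → ℕ
      members j = Σbox t (p ℕ.^ ν) (λ ξ → 𝟙 (fibVal ξ ℕ.≟ j))

      zeros-slices : zeros Q ν ≡ Σ< slice (suc ν)
      zeros-slices = trans (zeros-fiber Q ν)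
        (Σbox-partition t (p ℕ.^ ν) (λ ξ → roots (fib ξ) ν) fibVal (suc ν) (λ ξ → s≤s (cappedVal-≤ ν (fib ξ))))

      slice-≤ : ∀ G → 1 ℕ.≤ G → TotalDeg≤ Q G → 1 ℕ.≤ ν → ∀ j →
                slice j ℕ.^ G ℕ.≤ members j ℕ.^ G ℕ.* (G ℕ.^ G ℕ.* p ℕ.^ (ν ℕ.* (G ℕ.∸ 1) ℕ.+ j))
      slice-≤ G G≥1 deg 1≤ν j = minkowski-Σbox G G≥1 t (p ℕ.^ ν) _ _ _ pointwise
        where
        pointwise : ∀ ξ → (𝟙 (fibVal ξ ℕ.≟ j) ℕ.* roots (fib ξ) ν) ℕ.^ G ℕ.≤ 𝟙 (fibVal ξ ℕ.≟ j) ℕ.^ G ℕ.* (G ℕ.^ G ℕ.* p ℕ.^ (ν ℕ.* (G ℕ.∸ 1) ℕ.+ j))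
        pointwise ξ with fibVal ξ ℕ.≟ j
        ... | no  _    = ℕ.≤-trans (ℕ.≤-reflexive (0^-pos G G≥1)) z≤n
        ... | yes refl = subst₂ ℕ._≤_ (cong (ℕ._^ G) (sym (ℕ.*-identityˡ _)))
            (sym (trans (cong (ℕ._* (G ℕ.^ G ℕ.* p ℕ.^ (ν ℕ.* (G ℕ.∸ 1) ℕ.+ fibVal ξ))) (ℕ.^-zeroˡ G)) (ℕ.*-identityˡ _)))
            (roots-bound-valuation G G≥1 ν 1≤ν (fib ξ) (fibVal ξ) (fiber-deg G Q (map +_ ξ) deg)
              (cappedVal-≤ ν (fib ξ)) (cappedVal-∣ᵥ ν (fib ξ)) (cappedVal-maximal ν (fib ξ)))

      members-≤ : ∀ {c} → c ∈ Q → ∀ j → j ℕ.≤ ν → members j ℕ.≤ (p ℕ.^ (ν ℕ.∸ j)) ℕ.^ t ℕ.* zeros c j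
      members-≤ {c} c∈Q j j≤ν = begin
        members j                                           ≤⟨ Σbox-mono-≤ t (p ℕ.^ ν) pointwise ⟩
        countBox (P^ j) c (p ℕ.^ ν)                         ≡⟨ cong (countBox (P^ j) c) p^ν≡ ⟩
        countBox (P^ j) c (p ℕ.^ j ℕ.* p ℕ.^ (ν ℕ.∸ j))     ≡⟨ zeros-periodic c j (p ℕ.^ (ν ℕ.∸ j)) ⟩
        (p ℕ.^ (ν ℕ.∸ j)) ℕ.^ t ℕ.* zeros c j               ∎
        where
        open ℕ.≤-Reasoning
        p^ν≡ : p ℕ.^ ν ≡ p ℕ.^ j ℕ.* p ℕ.^ (ν ℕ.∸ j)
        p^ν≡ = trans (cong (p ℕ.^_) (sym (ℕ.m+[n∸m]≡n j≤ν))) (ℕ.^-distribˡ-+-* p j (ν ℕ.∸ j))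
        pointwise : ∀ ξ → 𝟙 (fibVal ξ ℕ.≟ j) ℕ.≤ 𝟙 (P^ j ∣? eval c (map +_ ξ))
        pointwise ξ with fibVal ξ ℕ.≟ j
        ... | no  _    = z≤n
        ... | yes refl = ℕ.≤-reflexive (sym (𝟙-yes _ (∣ᵥ-fiber-∈ (map +_ ξ) c∈Q (cappedVal-∣ᵥ ν (fib ξ)))))

    slice-arithmetic : ∀ G' t x j ν m → x ℕ.+ j ≡ ν →
      ((p ℕ.^ x) ℕ.^ suc t) ℕ.^ suc G' ℕ.* (suc G' ℕ.^ (suc t ℕ.* suc G') ℕ.* m ℕ.* p ℕ.^ (j ℕ.* (suc t ℕ.* suc G' ℕ.∸ 1)))
        ℕ.* (suc G' ℕ.^ suc G' ℕ.* p ℕ.^ (ν ℕ.* G' ℕ.+ j))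
      ≡ suc G' ℕ.^ (suc (suc t) ℕ.* suc G') ℕ.* m ℕ.* p ℕ.^ (ν ℕ.* (suc (suc t) ℕ.* suc G' ℕ.∸ 1))
    slice-arithmetic G' t x j _ m refl = begin
      ((p ℕ.^ x) ℕ.^ T) ℕ.^ G ℕ.* (G ℕ.^ (T ℕ.* G) ℕ.* m ℕ.* p ℕ.^ e₂) ℕ.* (G ℕ.^ G ℕ.* p ℕ.^ e₃)
        ≡⟨ cong (λ a → a ℕ.* (G ℕ.^ (T ℕ.* G) ℕ.* m ℕ.* p ℕ.^ e₂) ℕ.* (G ℕ.^ G ℕ.* p ℕ.^ e₃)) (trans (ℕ.^-*-assoc (p ℕ.^ x) T G) (ℕ.^-*-assoc p x (T ℕ.* G))) ⟩
      p ℕ.^ e₁ ℕ.* (G ℕ.^ (T ℕ.* G) ℕ.* m ℕ.* p ℕ.^ e₂) ℕ.* (G ℕ.^ G ℕ.* p ℕ.^ e₃)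
        ≡⟨ regroup (p ℕ.^ e₁) (G ℕ.^ (T ℕ.* G)) m (p ℕ.^ e₂) (G ℕ.^ G) (p ℕ.^ e₃) ⟩
      G ℕ.^ G ℕ.* G ℕ.^ (T ℕ.* G) ℕ.* m ℕ.* (p ℕ.^ e₁ ℕ.* p ℕ.^ e₂ ℕ.* p ℕ.^ e₃)
        ≡⟨ cong₂ (λ a b → a ℕ.* m ℕ.* b) (ℕ.^-distribˡ-+-* G G (T ℕ.* G))
                 (trans (ℕ.^-distribˡ-+-* p (e₁ ℕ.+ e₂) e₃) (cong (ℕ._* p ℕ.^ e₃) (ℕ.^-distribˡ-+-* p e₁ e₂))) ⟨
      G ℕ.^ (G ℕ.+ T ℕ.* G) ℕ.* m ℕ.* p ℕ.^ (e₁ ℕ.+ e₂ ℕ.+ e₃)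
        ≡⟨ cong (λ e → G ℕ.^ (G ℕ.+ T ℕ.* G) ℕ.* m ℕ.* p ℕ.^ e) (exponent x j t G') ⟩
      G ℕ.^ (suc T ℕ.* G) ℕ.* m ℕ.* p ℕ.^ ((x ℕ.+ j) ℕ.* (suc T ℕ.* G ℕ.∸ 1))
        ∎
      where
      open ≡-Reasoning
      G = suc G'
      T = suc t
      e₁ = x ℕ.* (T ℕ.* G)
      e₂ = j ℕ.* (T ℕ.* G ℕ.∸ 1)
      e₃ = (x ℕ.+ j) ℕ.* G' ℕ.+ j
      regroup : ∀ a b m c d e → a ℕ.* (b ℕ.* m ℕ.* c) ℕ.* (d ℕ.* e) ≡ d ℕ.* b ℕ.* m ℕ.* (a ℕ.* c ℕ.* e)
      regroup = ℕ-Solver.solve-∀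
      exponent : ∀ x j t G' → x ℕ.* (suc t ℕ.* suc G') ℕ.+ j ℕ.* (G' ℕ.+ t ℕ.* suc G') ℕ.+ ((x ℕ.+ j) ℕ.* G' ℕ.+ j)
                            ≡ (x ℕ.+ j) ℕ.* (G' ℕ.+ suc t ℕ.* suc G')
      exponent = ℕ-Solver.solve-∀

    slice-bound : ∀ t → ZerosBound t → ∀ (Q : Poly (suc (suc t))) G ν → 1 ℕ.≤ G → 1 ℕ.≤ ν → TotalDeg≤ Q G →
                  ∀ {c} e → c ∈ Q → Unit (coeff c e) → ∀ j → j ℕ.≤ ν →
                  Slices.slice Q ν j ℕ.^ G ℕ.≤ G ℕ.^ (suc (suc t) ℕ.* G) ℕ.* suc ν ℕ.^ (t ℕ.* G) ℕ.* p ℕ.^ (ν ℕ.* (suc (suc t) ℕ.* G ℕ.∸ 1))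
    slice-bound t IH Q G@(suc G') ν G≥1 1≤ν deg {c} e c∈Q unit-c j j≤ν = begin
      slice j ℕ.^ G                                                      ≤⟨ slice-≤ G G≥1 deg 1≤ν j ⟩
      members j ℕ.^ G ℕ.* Z                                              ≤⟨ ℕ.*-monoˡ-≤ Z (ℕ.^-monoˡ-≤ G (members-≤ c∈Q j j≤ν)) ⟩
      ((p ℕ.^ x) ℕ.^ suc t ℕ.* zeros c j) ℕ.^ G ℕ.* Z                    ≡⟨ cong (ℕ._* Z) (^-distribʳ-* ((p ℕ.^ x) ℕ.^ suc t) (zeros c j) G) ⟩
      ((p ℕ.^ x) ℕ.^ suc t) ℕ.^ G ℕ.* zeros c j ℕ.^ G ℕ.* Z              ≤⟨ ℕ.*-monoˡ-≤ Z (ℕ.*-monoʳ-≤ (((p ℕ.^ x) ℕ.^ suc t) ℕ.^ G) IH-c) ⟩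
      ((p ℕ.^ x) ℕ.^ suc t) ℕ.^ G ℕ.* (G ℕ.^ (suc t ℕ.* G) ℕ.* m ℕ.* p ℕ.^ (j ℕ.* (suc t ℕ.* G ℕ.∸ 1))) ℕ.* Z
                                                                         ≡⟨ slice-arithmetic G' t x j ν m (ℕ.m∸n+n≡m j≤ν) ⟩
      G ℕ.^ (suc (suc t) ℕ.* G) ℕ.* m ℕ.* p ℕ.^ (ν ℕ.* (suc (suc t) ℕ.* G ℕ.∸ 1)) ∎
      where
      open ℕ.≤-Reasoning
      open Slices Q ν
      x = ν ℕ.∸ j
      m = suc ν ℕ.^ (t ℕ.* G)
      Z = G ℕ.^ G ℕ.* p ℕ.^ (ν ℕ.* G' ℕ.+ j)
      IH-c : zeros c j ℕ.^ G ℕ.≤ G ℕ.^ (suc t ℕ.* G) ℕ.* m ℕ.* p ℕ.^ (j ℕ.* (suc t ℕ.* G ℕ.∸ 1))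
      IH-c = ℕ.≤-trans (IH c G j G≥1 (TotalDeg≤-∈ c∈Q deg) (e , unit-c))
        (ℕ.*-monoˡ-≤ (p ℕ.^ (j ℕ.* (suc t ℕ.* G ℕ.∸ 1))) (ℕ.*-monoʳ-≤ (G ℕ.^ (suc t ℕ.* G)) (ℕ.^-monoˡ-≤ (t ℕ.* G) (s≤s j≤ν))))

    zeros-bound-step : ∀ t → ZerosBound t → ZerosBound (suc t)
    zeros-bound-step t IH Q G zero      G≥1 deg prim = zeros-bound-at-0 Q G (suc (suc t) ℕ.* G) (suc t ℕ.* G) G≥1
    zeros-bound-step t IH Q G ν@(suc _) G≥1 deg (k ∷ e , unit) with coeff-∈ {A = Unit} Q k e ¬Unit-0 unit
    ... | c , c∈Q , unit-c = begin
      zeros Q ν ℕ.^ G                      ≡⟨ cong (ℕ._^ G) zeros-slices ⟩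
      Σ< slice (suc ν) ℕ.^ G
        ≤⟨ minkowski-Σ<-const G G≥1 slice Y (suc ν) (λ j j<1+ν → slice-bound t IH Q G ν G≥1 (s≤s z≤n) deg e c∈Q unit-c j (ℕ.≤-pred j<1+ν)) ⟩
      suc ν ℕ.^ G ℕ.* Y                    ≡⟨ regroup (suc ν ℕ.^ G) (G ℕ.^ (suc (suc t) ℕ.* G)) (suc ν ℕ.^ (t ℕ.* G)) X ⟩
      G ℕ.^ (suc (suc t) ℕ.* G) ℕ.* (suc ν ℕ.^ G ℕ.* suc ν ℕ.^ (t ℕ.* G)) ℕ.* X
                                           ≡⟨ cong (λ n → G ℕ.^ (suc (suc t) ℕ.* G) ℕ.* n ℕ.* X) (ℕ.^-distribˡ-+-* (suc ν) G (t ℕ.* G)) ⟨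
      G ℕ.^ (suc (suc t) ℕ.* G) ℕ.* suc ν ℕ.^ (suc t ℕ.* G) ℕ.* X ∎
      where
      open ℕ.≤-Reasoning
      open Slices Q ν using (slice; zeros-slices)
      X = p ℕ.^ (ν ℕ.* (suc (suc t) ℕ.* G ℕ.∸ 1))
      Y = G ℕ.^ (suc (suc t) ℕ.* G) ℕ.* suc ν ℕ.^ (t ℕ.* G) ℕ.* X
      regroup : ∀ a b c d → a ℕ.* (b ℕ.* c ℕ.* d) ≡ b ℕ.* (a ℕ.* c) ℕ.* d
      regroup = ℕ-Solver.solve-∀

    zeros-bound : ∀ t → ZerosBound t
    zeros-bound zero    = zeros-bound-univariate
    zeros-bound (suc t) = zeros-bound-step t (zeros-bound t)

    zeros-scaled : ∀ {t} (Q Q' : Poly t) v x → (∀ ξ → eval Q ξ ≡ P^ v * eval Q' ξ) → zeros Q (v ℕ.+ x) ≡ (p ℕ.^ v) ℕ.^ t ℕ.* zeros Q' x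
    zeros-scaled {t} Q Q' v x Q≡ = begin
      countBox (P^ (v ℕ.+ x)) Q (p ℕ.^ (v ℕ.+ x))     ≡⟨ cong (λ m → countBox m Q (p ℕ.^ (v ℕ.+ x))) (P^-+ v x) ⟩
      countBox (P^ v * P^ x) Q (p ℕ.^ (v ℕ.+ x))      ≡⟨ countBox-*-cancel (P^ v) (P^ x) (p ℕ.^ (v ℕ.+ x)) {{P^-nonZero v}} Q≡ ⟩
      countBox (P^ x) Q' (p ℕ.^ (v ℕ.+ x))            ≡⟨ cong (countBox (P^ x) Q') (trans (ℕ.^-distribˡ-+-* p v x) (ℕ.*-comm (p ℕ.^ v) (p ℕ.^ x))) ⟩
      countBox (P^ x) Q' (p ℕ.^ x ℕ.* p ℕ.^ v)        ≡⟨ zeros-periodic Q' x (p ℕ.^ v) ⟩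
      (p ℕ.^ v) ℕ.^ t ℕ.* zeros Q' x                  ∎
      where open ≡-Reasoning

    primitive-quotient : ∀ {t} (Q Q' : Poly t) v → (∀ e → coeff Q e ≡ P^ v * coeff Q' e) → ¬ p ℕ.^ suc v ℕ.∣ content Q → Primitive Q'
    primitive-quotient Q Q' v Q≡ p^1+v∤Q with all-or-unit Q'
    ... | inj₂ prim = prim
    ... | inj₁ P∣Q'      = ⊥-elim (p^1+v∤Q (content-greatest Q (p ℕ.^ suc v) (λ e →
            subst₂ _∣_ (trans (*-comm (P^ v) P) (sym (P^-suc v))) (sym (Q≡ e)) (*-monoʳ-∣ (P^ v) (P∣Q' e)))))

    zeros-bound-trivial : ∀ t (Q : Poly (suc t)) g → 1 ℕ.≤ g → ∀ ν v → ν ℕ.≤ v →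
      zeros Q ν ℕ.^ g ℕ.≤ g ℕ.^ (suc t ℕ.* g) ℕ.* suc ν ℕ.^ (t ℕ.* g) ℕ.* p ℕ.^ (ν ℕ.* (suc t ℕ.* g ℕ.∸ 1) ℕ.+ v)
    zeros-bound-trivial t Q g@(suc g') g≥1 ν v ν≤v = begin
      zeros Q ν ℕ.^ g                               ≤⟨ ℕ.^-monoˡ-≤ g (countBox-≤ (P^ ν) Q (p ℕ.^ ν)) ⟩
      ((p ℕ.^ ν) ℕ.^ suc t) ℕ.^ g                   ≡⟨ trans (ℕ.^-*-assoc (p ℕ.^ ν) (suc t) g) (ℕ.^-*-assoc p ν (suc t ℕ.* g)) ⟩
      p ℕ.^ (ν ℕ.* suc k)                           ≡⟨ cong (p ℕ.^_) (trans (ℕ.*-suc ν k) (ℕ.+-comm ν (ν ℕ.* k))) ⟩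
      p ℕ.^ (ν ℕ.* k ℕ.+ ν)                         ≤⟨ ℕ.^-monoʳ-≤ p (ℕ.+-monoʳ-≤ (ν ℕ.* k) ν≤v) ⟩
      p ℕ.^ (ν ℕ.* k ℕ.+ v)                         ≤⟨ ℕ.m≤n*m _ (g ℕ.^ (suc t ℕ.* g) ℕ.* suc ν ℕ.^ (t ℕ.* g)) {{prefactor≢0}} ⟩
      g ℕ.^ (suc t ℕ.* g) ℕ.* suc ν ℕ.^ (t ℕ.* g) ℕ.* p ℕ.^ (ν ℕ.* k ℕ.+ v)   ∎
      where
      open ℕ.≤-Reasoning
      k = g' ℕ.+ t ℕ.* g
      prefactor≢0 = ℕ.m*n≢0 (g ℕ.^ (suc t ℕ.* g)) (suc ν ℕ.^ (t ℕ.* g)) {{ℕ.m^n≢0 g (suc t ℕ.* g)}} {{ℕ.m^n≢0 (suc ν) (t ℕ.* g)}}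

    zeros-bound-reduced : ∀ t (Q : Poly (suc t)) g → 1 ℕ.≤ g → TotalDeg≤ Q g → ∀ v x → p ℕ.^ v ℕ.∣ content Q → ¬ p ℕ.^ suc v ℕ.∣ content Q →
      zeros Q (v ℕ.+ x) ℕ.^ g ℕ.≤ g ℕ.^ (suc t ℕ.* g) ℕ.* suc (v ℕ.+ x) ℕ.^ (t ℕ.* g) ℕ.* p ℕ.^ ((v ℕ.+ x) ℕ.* (suc t ℕ.* g ℕ.∸ 1) ℕ.+ v)
    zeros-bound-reduced t Q g@(suc g') g≥1 deg v x p^v∣Q p^1+v∤Q with divide-content Q (p ℕ.^ v) p^v∣Q
    ... | Q' , coeff≡ , eval≡ = begin
      zeros Q (v ℕ.+ x) ℕ.^ g                                             ≡⟨ cong (ℕ._^ g) (zeros-scaled Q Q' v x eval≡) ⟩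
      ((p ℕ.^ v) ℕ.^ suc t ℕ.* zeros Q' x) ℕ.^ g                          ≡⟨ ^-distribʳ-* ((p ℕ.^ v) ℕ.^ suc t) (zeros Q' x) g ⟩
      ((p ℕ.^ v) ℕ.^ suc t) ℕ.^ g ℕ.* zeros Q' x ℕ.^ g                    ≤⟨ ℕ.*-monoʳ-≤ (((p ℕ.^ v) ℕ.^ suc t) ℕ.^ g) bound-Q' ⟩
      ((p ℕ.^ v) ℕ.^ suc t) ℕ.^ g ℕ.* (A ℕ.* p ℕ.^ (x ℕ.* k))            ≡⟨ cong (ℕ._* (A ℕ.* p ℕ.^ (x ℕ.* k))) (trans (ℕ.^-*-assoc (p ℕ.^ v) (suc t) g) (ℕ.^-*-assoc p v (suc t ℕ.* g))) ⟩
      p ℕ.^ (v ℕ.* suc k) ℕ.* (A ℕ.* p ℕ.^ (x ℕ.* k))                    ≡⟨ x∙yz≈y∙xz (p ℕ.^ (v ℕ.* suc k)) A (p ℕ.^ (x ℕ.* k)) ⟩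
      A ℕ.* (p ℕ.^ (v ℕ.* suc k) ℕ.* p ℕ.^ (x ℕ.* k))                    ≡⟨ cong (A ℕ.*_) (ℕ.^-distribˡ-+-* p (v ℕ.* suc k) (x ℕ.* k)) ⟨
      A ℕ.* p ℕ.^ (v ℕ.* suc k ℕ.+ x ℕ.* k)                              ≡⟨ cong (λ e → A ℕ.* p ℕ.^ e) (exponent v x k) ⟩
      A ℕ.* p ℕ.^ ((v ℕ.+ x) ℕ.* k ℕ.+ v)                                ∎
      where
      open ℕ.≤-Reasoning
      k = g' ℕ.+ t ℕ.* g
      A = g ℕ.^ (suc t ℕ.* g) ℕ.* suc (v ℕ.+ x) ℕ.^ (t ℕ.* g)
      exponent : ∀ v x k → v ℕ.* suc k ℕ.+ x ℕ.* k ≡ (v ℕ.+ x) ℕ.* k ℕ.+ v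
      exponent = ℕ-Solver.solve-∀
      bound-Q' : zeros Q' x ℕ.^ g ℕ.≤ A ℕ.* p ℕ.^ (x ℕ.* k)
      bound-Q' = ℕ.≤-trans
        (zeros-bound t Q' g x g≥1 (TotalDeg≤-quotient (P^ v) Q Q' {{P^-nonZero v}} coeff≡ deg) (primitive-quotient Q Q' v coeff≡ p^1+v∤Q))
        (ℕ.*-monoˡ-≤ (p ℕ.^ (x ℕ.* k)) (ℕ.*-monoʳ-≤ (g ℕ.^ (suc t ℕ.* g)) (ℕ.^-monoˡ-≤ (t ℕ.* g) (s≤s (ℕ.m≤n+m x v)))))

    zeros-bound-valuation : ∀ t (Q : Poly (suc t)) g → 1 ℕ.≤ g → TotalDeg≤ Q g → ∀ ν v → p ℕ.^ v ℕ.∣ content Q → ¬ p ℕ.^ suc v ℕ.∣ content Q →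
      zeros Q ν ℕ.^ g ℕ.≤ g ℕ.^ (suc t ℕ.* g) ℕ.* suc ν ℕ.^ (t ℕ.* g) ℕ.* p ℕ.^ (ν ℕ.* (suc t ℕ.* g ℕ.∸ 1) ℕ.+ v)
    zeros-bound-valuation t Q g g≥1 deg ν v p^v∣Q p^1+v∤Q with ℕ.≤-total ν v
    ... | inj₁ ν≤v = zeros-bound-trivial t Q g g≥1 ν v ν≤v
    ... | inj₂ v≤ν = subst (λ ν → zeros Q ν ℕ.^ g ℕ.≤ g ℕ.^ (suc t ℕ.* g) ℕ.* suc ν ℕ.^ (t ℕ.* g) ℕ.* p ℕ.^ (ν ℕ.* (suc t ℕ.* g ℕ.∸ 1) ℕ.+ v))
                           (ℕ.m+[n∸m]≡n v≤ν) (zeros-bound-reduced t Q g g≥1 deg v (ν ℕ.∸ v) p^v∣Q p^1+v∤Q)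

open Congruences

open import Defs using (HasDegree; IsValuation)
open import Data.Nat using (suc; _*_; _^_; _+_; _∸_; _≤_)
open import Data.Nat.Properties using (module ≤-Reasoning)
open import Data.Product using (_,_)
open import Relation.Binary.PropositionalEquality using (cong)

lemma4p2 : (t : ℕ) → 1 ≤ t → (Q : Poly t) → (g : ℕ) → 1 ≤ g → HasDegree Q g →
    (p : ℕ) → Prime p → (ν : ℕ) → 1 ≤ ν → (v : ℕ) → IsValuation p (content Q) v →
    rhoPlus Q (p ^ ν) ^ g ≤ g ^ (t * g) * suc ν ^ ((t ∸ 1) * g) * p ^ (ν * (t * g ∸ 1) + v)
lemma4p2 (suc t) _ Q g g≥1 (_ , deg≤g) p p-prime ν _ v (p^v∣c , p^1+v∤c) = begin
  rhoPlus Q (p ^ ν) ^ g   ≡⟨ cong (_^ g) (rhoPlus≡countBox Q (p ^ ν)) ⟩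
  zeros Q ν ^ g           ≤⟨ zeros-bound-valuation t Q g g≥1 deg≤g ν v p^v∣c p^1+v∤c ⟩
  g ^ (suc t * g) * suc ν ^ (t * g) * p ^ (ν * (suc t * g ∸ 1) + v) ∎
  where
  open ≤-Reasoning
  open Padic p p-prime using (zeros; zeros-bound-valuation)
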